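{- For every integer $n\ge1$, $\mathrm{pk}_n(123,231)=\mathrm{pk}_n(123,312)=\frac16n(n-1)(n+4)+1$.
   Context: For a positive integer $n$, $[n]=\{1,\dots,n\}$. A function $f:[n]\to[n]$ is a parking function if for every $i\in[n]$, $|\{j\in[n]: f(j)\le i\}|\ge i$ (equivalently, in the usual car-parking process where car $i$ prefers spot $f(i)$ and takes the first free spot at or after it, all cars park). The parking permutation $\rho_f\in S_n$ is defined by: spot $i$ is occupied by car $\rho_f(i)$. A permutation $\pi\in S_n$ contains $\sigma\in S_m$ as a pattern if there exist $1\le i_1<\dots<i_m\le n$ with $\pi(i_a)<\pi(i_b)$ iff $\sigma(a)<\sigma(b)$ for all $a,b$; otherwise it avoids $\sigma$. $\mathrm{pk}_n(\sigma_1,\dots,\sigma_k)$ is the number of parking functions $f:[n]\to[n]$ with $\rho_f$ avoiding every $\sigma_i$. -}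

module Defs where

open import Data.Nat using (ℕ; zero; suc; _+_; _*_; _∸_; _<ᵇ_; _≡ᵇ_; _≤ᵇ_)
open import Data.Bool using (Bool; true; false; _∧_; _∨_; not; if_then_else_)
open import Data.List using (List; []; _∷_; map; length; filter; concatMap; upTo; foldr; lookup; allFin; replicate)
open import Data.Fin using (Fin)
open import Relation.Nullary.Decidable using (Dec)
open import Data.Bool.Properties using (T?)

-- Conventions: a function f : [n] → [n] is represented by the list
-- (f 1, f 2, ..., f n) of naturals, each in {1,...,n}.
-- A permutation of [n] is represented by its one-line notation
-- (π 1, ..., π n).  Cars and spots are numbered 1..n.

range : ℕ → ℕ → List ℕ
range a zero    = []
range a (suc k) = a ∷ range (suc a) k

allWords : ℕ → ℕ → List (List ℕ)
allWords zero    n = [] ∷ []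
allWords (suc m) n = concatMap (λ x → map (x ∷_) (allWords m n)) (range 1 n)

allFunctions : ℕ → List (List ℕ)
allFunctions n = allWords n n

count : {A : Set} → (A → Bool) → List A → ℕ
count p []       = 0
count p (x ∷ xs) = if p x then suc (count p xs) else count p xs

allB : {A : Set} → (A → Bool) → List A → Bool
allB p []       = true
allB p (x ∷ xs) = p x ∧ allB p xs

anyB : {A : Set} → (A → Bool) → List A → Bool
anyB p []       = false
anyB p (x ∷ xs) = p x ∨ anyB p xs

isParkingFunction : ℕ → List ℕ → Bool
isParkingFunction n f = allB (λ i → i ≤ᵇ count (λ v → v ≤ᵇ i) f) (range 1 n)

-- Parking process.  The occupancy of the street is a list indexed by
-- spots 1..n; entry 0 means "empty", entry c ≥ 1 means "occupied by car c".

-- put car c in the first free spot at or after spot p,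
-- where the first entry of the list is spot s
placeFrom : ℕ → ℕ → ℕ → List ℕ → List ℕ
placeFrom s p c []       = []
placeFrom s p c (o ∷ os) =
  if (p ≤ᵇ s) ∧ (o ≡ᵇ 0) then c ∷ os else o ∷ placeFrom (suc s) p c os

parkCars : ℕ → List ℕ → List ℕ → List ℕ
parkCars c []       occ = occ
parkCars c (p ∷ ps) occ = parkCars (suc c) ps (placeFrom 1 p c occ)

-- the parking permutation ρ_f in one-line notation: entry i is the car in spot i
-- (for a parking function every spot gets filled, so this is a permutation)
parkingPermutation : ℕ → List ℕ → List ℕ
parkingPermutation n f = parkCars 1 f (replicate n 0)

subseqs : {A : Set} → ℕ → List A → List (List A)
subseqs zero    xs       = [] ∷ []
subseqs (suc m) []       = []
subseqs (suc m) (x ∷ xs) = map (x ∷_) (subseqs m xs) Data.List.++ subseqs (suc m) xs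

orderIso : List ℕ → List ℕ → Bool
orderIso xs ys = (length xs ≡ᵇ length ys) ∧
  allB (λ a → allB (λ b → eqB (lt xs a b) (lt ys a b)) idx) idx
  where
  idx : List ℕ
  idx = range 0 (length xs)
  at : List ℕ → ℕ → ℕ
  at []       _       = 0
  at (z ∷ zs) zero    = z
  at (z ∷ zs) (suc k) = at zs k
  lt : List ℕ → ℕ → ℕ → Bool
  lt zs a b = at zs a <ᵇ at zs b
  eqB : Bool → Bool → Bool
  eqB true  q = q
  eqB false q = not q

containsPattern : List ℕ → List ℕ → Bool
containsPattern π σ = anyB (orderIso σ) (subseqs (length σ) π)

avoidsAll : List ℕ → List (List ℕ) → Bool
avoidsAll π σs = allB (λ σ → not (containsPattern π σ)) σs

pk : ℕ → List (List ℕ) → ℕ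
pk n σs = count (λ f → isParkingFunction n f ∧ avoidsAll (parkingPermutation n f) σs)
                (allFunctions n)

open import Relation.Binary.PropositionalEquality using (_≡_; refl)
private
  t1 : pk 3 [] ≡ 16
  t1 = refl
  t2 : pk 3 ((1 ∷ 2 ∷ 3 ∷ []) ∷ (2 ∷ 3 ∷ 1 ∷ []) ∷ []) ≡ 8
  t2 = refl
  t3 : pk 4 ((1 ∷ 2 ∷ 3 ∷ []) ∷ (3 ∷ 1 ∷ 2 ∷ []) ∷ []) ≡ 17
  t3 = refl
  t4 : pk 5 ((1 ∷ 2 ∷ 3 ∷ []) ∷ (2 ∷ 3 ∷ 1 ∷ []) ∷ []) ≡ 31
  t4 = refl

module Submission where

-- Preferences f park as the permutation π iff each car π(q) prefers a spot
-- j ≤ q such that spots j .. q−1 hold earlier cars.  A permutation avoids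
-- {123, 231} iff it is H L G with decreasing blocks, H above L ∪ G and L below
-- G; it avoids {123, 312} iff it is M T B with decreasing blocks, T above M
-- above B.  Apart from the decreasing permutation (one parking function), such a
-- permutation has a single ascent: every car must prefer its own spot except the
-- car at the ascent, which has x + 1 choices, x = |L| resp. |M|.  Summing x + 1
-- over block sizes x, z ≥ 1, y ≥ 0 with x + y + z = n gives n(n−1)(n+4)/6.

open import Defs
open import Algebra.Properties.CommutativeSemigroup using (x∙yz≈y∙xz)
open import Data.Bool using (Bool; true; false; _∧_; _∨_; not; if_then_else_)
open import Data.Bool.Properties using (∨-assoc) renaming (_≟_ to _≟ᵇ_)
open import Data.Empty using (⊥; ⊥-elim)
open import Data.List using (List; []; _∷_; _++_; length; map; concatMap; replicate; take; drop; filter)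
open import Data.List.Membership.Propositional using (_∈_; find)
open import Data.List.Membership.Propositional.Properties
  using (∈-++⁺ˡ; ∈-++⁺ʳ; ∈-++⁻; ∈-map⁺; ∈-map⁻; ∈-concatMap⁺; ∈-concatMap⁻; ∈-filter⁺; ∈-filter⁻)
open import Data.List.Membership.Propositional.Properties.WithK using (unique∧set⇒bag)
open import Data.List.Properties using (length-++; length-map; length-replicate; ++-assoc; ++-identityʳ; ∷-injective; take-[]; drop-all)
open import Data.List.Relation.Binary.BagAndSetEquality using (∼bag⇒↭)
open import Data.List.Relation.Binary.Permutation.Propositional using (_↭_; ↭-trans; ↭-reflexive; ↭⇒↭ₛ)
import Data.List.Relation.Binary.Permutation.Propositional.Properties as Permₚ
open import Data.List.Relation.Binary.Sublist.Propositional using (_⊆_; []; _∷_; _∷ʳ_; ⊆-refl; ⊆-trans; minimum; from∈; to∈)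
import Data.List.Relation.Binary.Sublist.Propositional.Properties as Sublistₚ
open import Data.List.Relation.Unary.All as All using (All; []; _∷_)
import Data.List.Relation.Unary.All.Properties as Allₚ
open import Data.List.Relation.Unary.AllPairs as AllPairs using (AllPairs; []; _∷_)
import Data.List.Relation.Unary.AllPairs.Properties as AllPairsₚ
open import Data.List.Relation.Unary.Any as Any using (Any; here; there)
open import Data.List.Relation.Unary.Unique.Propositional using (Unique)
import Data.List.Relation.Unary.Unique.Propositional.Properties as Uniqueₚ
open import Data.Nat using (ℕ; zero; suc; pred; _+_; _*_; _∸_; _/_; _≤_; _<_; _>_; _≤ᵇ_; _<ᵇ_; _≡ᵇ_; z≤n; s≤s; s≤s⁻¹)
open import Data.Nat.DivMod using (m*n/n≡m)
open import Data.Nat.Properties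
open import Data.Nat.Tactic.RingSolver using (solve-∀)
open import Data.Product using (∃; _×_; _,_; proj₁; proj₂)
open import Data.Sum using (_⊎_; inj₁; inj₂)
open import Data.Unit using (tt)
open import Function.Base using (case_of_)
open import Function.Bundles using (_⇔_; mk⇔; Equivalence)
open import Relation.Binary using (tri<; tri≈; tri>)
open import Relation.Binary.PropositionalEquality
open import Data.List.Relation.Binary.Permutation.Setoid.Properties (setoid ℕ) using (Unique-resp-↭)
open import Relation.Nullary using (¬_; yes; no)

T⇒≡true : ∀ {b} → Data.Bool.T b → b ≡ true
T⇒≡true {true} _ = refl

≡true⇒T : ∀ {b} → b ≡ true → Data.Bool.T b
≡true⇒T refl = tt

¬T⇒≡false : ∀ {b} → ¬ Data.Bool.T b → b ≡ false
¬T⇒≡false {true} p = ⊥-elim (p tt)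
¬T⇒≡false {false} _ = refl

true≢false : true ≢ false
true≢false ()

≤ᵇ-true : ∀ {m n} → m ≤ n → (m ≤ᵇ n) ≡ true
≤ᵇ-true p = T⇒≡true (≤⇒≤ᵇ p)

≤ᵇ-false : ∀ {m n} → n < m → (m ≤ᵇ n) ≡ false
≤ᵇ-false {m} {n} p = ¬T⇒≡false (λ t → <⇒≱ p (≤ᵇ⇒≤ m n t))

<ᵇ-true : ∀ {m n} → m < n → (m <ᵇ n) ≡ true
<ᵇ-true p = T⇒≡true (<⇒<ᵇ p)

<ᵇ-false : ∀ {m n} → n ≤ m → (m <ᵇ n) ≡ false
<ᵇ-false {m} {n} p = ¬T⇒≡false (λ t → ≤⇒≯ p (<ᵇ⇒< m n t))

≡ᵇ-true : ∀ m → (m ≡ᵇ m) ≡ true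
≡ᵇ-true m = T⇒≡true (≡⇒≡ᵇ m m refl)

≡ᵇ-false : ∀ {m n} → m ≢ n → (m ≡ᵇ n) ≡ false
≡ᵇ-false {m} {n} p = ¬T⇒≡false (λ t → p (≡ᵇ⇒≡ m n t))

≤ᵇ-sound : ∀ {m n} → (m ≤ᵇ n) ≡ true → m ≤ n
≤ᵇ-sound {m} {n} e = ≤ᵇ⇒≤ m n (≡true⇒T e)

<ᵇ-sound : ∀ {m n} → (m <ᵇ n) ≡ true → m < n
<ᵇ-sound {m} {n} e = <ᵇ⇒< m n (≡true⇒T e)

≡ᵇ-sound : ∀ {m n} → (m ≡ᵇ n) ≡ true → m ≡ n
≡ᵇ-sound {m} {n} e = ≡ᵇ⇒≡ m n (≡true⇒T e)

∧-trueˡ : ∀ {a b} → (a ∧ b) ≡ true → a ≡ true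
∧-trueˡ {true} e = refl

∧-trueʳ : ∀ {a b} → (a ∧ b) ≡ true → b ≡ true
∧-trueʳ {true} e = e

-- Positional access to the street and to preference lists, 0-based.  Out of
-- range, `at` returns the junk value 0, which is also the "empty spot" marker.
at : List ℕ → ℕ → ℕ
at [] _ = 0
at (x ∷ xs) zero = x
at (x ∷ xs) (suc k) = at xs k

setAt : List ℕ → ℕ → ℕ → List ℕ
setAt [] _ _ = []
setAt (x ∷ xs) zero c = c ∷ xs
setAt (x ∷ xs) (suc q) c = x ∷ setAt xs q c

length-setAt : ∀ xs q c → length (setAt xs q c) ≡ length xs
length-setAt [] q c = refl
length-setAt (x ∷ xs) zero c = refl
length-setAt (x ∷ xs) (suc q) c = cong suc (length-setAt xs q c)

at-setAt-≡ : ∀ xs q c → q < length xs → at (setAt xs q c) q ≡ c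
at-setAt-≡ (x ∷ xs) zero c _ = refl
at-setAt-≡ (x ∷ xs) (suc q) c (s≤s lt) = at-setAt-≡ xs q c lt

at-setAt-≢ : ∀ xs q c k → k ≢ q → at (setAt xs q c) k ≡ at xs k
at-setAt-≢ [] q c k ne = refl
at-setAt-≢ (x ∷ xs) zero c zero ne = ⊥-elim (ne refl)
at-setAt-≢ (x ∷ xs) zero c (suc k) ne = refl
at-setAt-≢ (x ∷ xs) (suc q) c zero ne = refl
at-setAt-≢ (x ∷ xs) (suc q) c (suc k) ne = at-setAt-≢ xs q c k (λ e → ne (cong suc e))

at-setAt-≤ : ∀ xs q c k b → (∀ i → at xs i ≤ b) → c ≤ b → at (setAt xs q c) k ≤ b
at-setAt-≤ [] q c k b h cb = z≤n
at-setAt-≤ (x ∷ xs) zero c zero b h cb = cb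
at-setAt-≤ (x ∷ xs) zero c (suc k) b h cb = h (suc k)
at-setAt-≤ (x ∷ xs) (suc q) c zero b h cb = h zero
at-setAt-≤ (x ∷ xs) (suc q) c (suc k) b h cb = at-setAt-≤ xs q c k b (λ i → h (suc i)) cb

at-++ˡ : ∀ xs ys k → k < length xs → at (xs ++ ys) k ≡ at xs k
at-++ˡ (x ∷ xs) ys zero _ = refl
at-++ˡ (x ∷ xs) ys (suc k) (s≤s lt) = at-++ˡ xs ys k lt

at-++ʳ : ∀ xs ys k → at (xs ++ ys) (length xs + k) ≡ at ys k
at-++ʳ [] ys k = refl
at-++ʳ (x ∷ xs) ys k = at-++ʳ xs ys k

at-replicate-0 : ∀ m i → at (replicate m 0) i ≡ 0
at-replicate-0 zero i = refl
at-replicate-0 (suc m) zero = refl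
at-replicate-0 (suc m) (suc i) = at-replicate-0 m i

at-extensionality : ∀ xs ys → length xs ≡ length ys → (∀ k → k < length xs → at xs k ≡ at ys k) → xs ≡ ys
at-extensionality [] [] _ _ = refl
at-extensionality (x ∷ xs) (y ∷ ys) e h =
  cong₂ _∷_ (h 0 (s≤s z≤n)) (at-extensionality xs ys (suc-injective e) (λ k lt → h (suc k) (s≤s lt)))

at-∈ : ∀ xs i → i < length xs → at xs i ∈ xs
at-∈ (x ∷ xs) zero _ = here refl
at-∈ (x ∷ xs) (suc i) (s≤s lt) = there (at-∈ xs i lt)

∈⇒at : ∀ {v} xs → v ∈ xs → ∃ λ q → q < length xs × at xs q ≡ v
∈⇒at (x ∷ xs) (here refl) = 0 , s≤s z≤n , refl
∈⇒at (x ∷ xs) (there i) with ∈⇒at xs i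
... | q , lt , e = suc q , s≤s lt , e

All-at : ∀ {P : ℕ → Set} {xs} → All P xs → ∀ i → i < length xs → P (at xs i)
All-at {xs = xs} a i lt = All.lookup a (at-∈ xs i lt)

at⇒All : ∀ {P : ℕ → Set} xs → (∀ i → i < length xs → P (at xs i)) → All P xs
at⇒All {P} xs h = All.tabulate λ m → let q , lt , e = ∈⇒at xs m in subst P e (h q lt)

Unique⇒at-injective : ∀ xs → Unique xs → ∀ i j → i < length xs → j < length xs → at xs i ≡ at xs j → i ≡ j
Unique⇒at-injective (x ∷ xs) u zero zero _ _ _ = refl
Unique⇒at-injective (x ∷ xs) (x∉ ∷ u) zero (suc j) _ (s≤s lj) e = ⊥-elim (All.lookup x∉ (at-∈ xs j lj) e)
Unique⇒at-injective (x ∷ xs) (x∉ ∷ u) (suc i) zero (s≤s li) _ e = ⊥-elim (All.lookup x∉ (at-∈ xs i li) (sym e))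
Unique⇒at-injective (x ∷ xs) (x∉ ∷ u) (suc i) (suc j) (s≤s li) (s≤s lj) e = cong suc (Unique⇒at-injective xs u i j li lj e)

at-injective⇒Unique : ∀ xs → (∀ i j → i < length xs → j < length xs → at xs i ≡ at xs j → i ≡ j) → Unique xs
at-injective⇒Unique [] _ = []
at-injective⇒Unique (x ∷ xs) h =
  All.tabulate (λ m e → let q , lt , e′ = ∈⇒at xs m in 0≢1+n (h 0 (suc q) (s≤s z≤n) (s≤s lt) (trans e (sym e′))))
  ∷ at-injective⇒Unique xs (λ i j li lj e → suc-injective (h (suc i) (suc j) (s≤s li) (s≤s lj) e))

-- The parking process

data Placement (s p c : ℕ) (xs : List ℕ) : Set where
  noFreeSpot : placeFrom s p c xs ≡ xs → (∀ k → k < length xs → p ≤ s + k → at xs k ≢ 0) → Placement s p c xs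
  parksAt : (q : ℕ) → q < length xs → p ≤ s + q → at xs q ≡ 0 →
            (∀ k → k < q → p ≤ s + k → at xs k ≢ 0) → placeFrom s p c xs ≡ setAt xs q c → Placement s p c xs

placement : ∀ s p c xs → Placement s p c xs
placement s p c [] = noFreeSpot refl (λ k ())
placement s p c (o ∷ os) with (p ≤ᵇ s) ∧ (o ≡ᵇ 0) in e
... | true = parksAt 0 (s≤s z≤n) (subst (p ≤_) (sym (+-identityʳ s)) (≤ᵇ-sound (∧-trueˡ e))) (≡ᵇ-sound (∧-trueʳ e))
               (λ k ()) (cong (λ b → if b then c ∷ os else o ∷ placeFrom (suc s) p c os) e)
... | false = shift (placement (suc s) p c os)
  where
  here-occupied : p ≤ s + 0 → o ≢ 0
  here-occupied le o0 = true≢false (trans (sym (cong₂ _∧_ (≤ᵇ-true (subst (p ≤_) (+-identityʳ s) le)) (cong (_≡ᵇ 0) o0))) e)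
  step : placeFrom s p c (o ∷ os) ≡ o ∷ placeFrom (suc s) p c os
  step = cong (λ b → if b then c ∷ os else o ∷ placeFrom (suc s) p c os) e
  reindex : ∀ k → p ≤ s + suc k → p ≤ suc s + k
  reindex k le = subst (p ≤_) (+-suc s k) le
  shift : Placement (suc s) p c os → Placement s p c (o ∷ os)
  shift (noFreeSpot eq h) = noFreeSpot (trans step (cong (o ∷_) eq))
    λ { zero _ le → here-occupied le ; (suc k) (s≤s lt) le → h k lt (reindex k le) }
  shift (parksAt q lt le z h eq) = parksAt (suc q) (s≤s lt) (subst (p ≤_) (sym (+-suc s q)) le) z
    (λ { zero _ le′ → here-occupied le′ ; (suc k) (s≤s lt′) le′ → h k lt′ (reindex k le′) }) (trans step (cong (o ∷_) eq))

placeFrom-firstFree : ∀ s p c xs q → q < length xs → p ≤ s + q → at xs q ≡ 0 →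
  (∀ k → k < q → p ≤ s + k → at xs k ≢ 0) → placeFrom s p c xs ≡ setAt xs q c
placeFrom-firstFree s p c xs q lt le z h with placement s p c xs
... | noFreeSpot _ h′ = ⊥-elim (h′ q lt le z)
... | parksAt q′ lt′ le′ z′ h′ eq with <-cmp q q′
...   | tri< a _ _ = ⊥-elim (h′ q a le z)
...   | tri≈ _ refl _ = eq
...   | tri> _ _ c′ = ⊥-elim (h q′ c′ le′ z′)

length-placeFrom : ∀ s p c xs → length (placeFrom s p c xs) ≡ length xs
length-placeFrom s p c xs with placement s p c xs
... | noFreeSpot eq _ = cong length eq
... | parksAt q _ _ _ _ eq = trans (cong length eq) (length-setAt xs q c)

countOccupied : List ℕ → ℕ
countOccupied [] = 0
countOccupied (x ∷ xs) = if x ≡ᵇ 0 then countOccupied xs else suc (countOccupied xs)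

countOccupied-take-≤ : ∀ xs i → countOccupied (take i xs) ≤ i
countOccupied-take-≤ [] i = subst (_≤ i) (cong countOccupied (sym (take-[] i))) z≤n
countOccupied-take-≤ (x ∷ xs) zero = z≤n
countOccupied-take-≤ (x ∷ xs) (suc i) with x ≡ᵇ 0
... | true = m≤n⇒m≤1+n (countOccupied-take-≤ xs i)
... | false = s≤s (countOccupied-take-≤ xs i)

countOccupied-take-full : ∀ xs i → (∀ k → k < length xs → at xs k ≢ 0) → i ≤ length xs → countOccupied (take i xs) ≡ i
countOccupied-take-full xs zero h le = refl
countOccupied-take-full (x ∷ xs) (suc i) h (s≤s le) with x ≡ᵇ 0 in e
... | true = ⊥-elim (h 0 (s≤s z≤n) (≡ᵇ-sound e))
... | false = cong suc (countOccupied-take-full xs i (λ k lt → h (suc k) (s≤s lt)) le)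

countOccupied-take-replicate-0 : ∀ i m → countOccupied (take i (replicate m 0)) ≡ 0
countOccupied-take-replicate-0 zero m = refl
countOccupied-take-replicate-0 (suc i) zero = refl
countOccupied-take-replicate-0 (suc i) (suc m) = countOccupied-take-replicate-0 i m

take-setAt-beyond : ∀ xs q c i → i ≤ q → take i (setAt xs q c) ≡ take i xs
take-setAt-beyond [] q c i le = refl
take-setAt-beyond (x ∷ xs) q c zero le = refl
take-setAt-beyond (x ∷ xs) (suc q) c (suc i) (s≤s le) = cong (x ∷_) (take-setAt-beyond xs q c i le)

countOccupied-take-fill : ∀ xs q k i → q < i → at xs q ≡ 0 → q < length xs →
  countOccupied (take i (setAt xs q (suc k))) ≡ suc (countOccupied (take i xs))
countOccupied-take-fill (x ∷ xs) zero k (suc i) lt z _ rewrite z = refl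
countOccupied-take-fill (x ∷ xs) (suc q) k (suc i) (s≤s lt) z (s≤s lq) with x ≡ᵇ 0
... | true = countOccupied-take-fill xs q k i lt z lq
... | false = cong suc (countOccupied-take-fill xs q k i lt z lq)

countOccupied-take-fill-≤ : ∀ xs q k i → at xs q ≡ 0 → q < length xs →
  countOccupied (take i xs) ≤ countOccupied (take i (setAt xs q (suc k)))
countOccupied-take-fill-≤ xs q k i z lq with q <? i
... | yes lt = ≤-trans (n≤1+n _) (≤-reflexive (sym (countOccupied-take-fill xs q k i lt z lq)))
... | no nlt = ≤-reflexive (cong countOccupied (sym (take-setAt-beyond xs q (suc k) i (≮⇒≥ nlt))))

allB-range⁻ : ∀ {p : ℕ → Bool} a k → allB p (range a k) ≡ true → ∀ i → a ≤ i → i < a + k → p i ≡ true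
allB-range⁻ a zero h i le lt = ⊥-elim (<⇒≱ lt (subst (_≤ i) (sym (+-identityʳ a)) le))
allB-range⁻ {p} a (suc k) h i le lt with a ≟ i
... | yes refl = ∧-trueˡ h
... | no ne = allB-range⁻ (suc a) k (∧-trueʳ {p a} h) i (≤∧≢⇒< le ne) (subst (i <_) (+-suc a k) lt)

allB-range⁺ : ∀ {p : ℕ → Bool} a k → (∀ i → a ≤ i → i < a + k → p i ≡ true) → allB p (range a k) ≡ true
allB-range⁺ a zero h = refl
allB-range⁺ {p} a (suc k) h rewrite h a ≤-refl (subst (a <_) (sym (+-suc a k)) (s≤s (m≤m+n a k))) =
  allB-range⁺ (suc a) k (λ i le lt → h i (≤-trans (n≤1+n a) le) (subst (i <_) (sym (+-suc a k)) lt))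

b2n : Bool → ℕ
b2n true = 1
b2n false = 0

prefersAtMost : List ℕ → ℕ → ℕ → ℕ
prefersAtMost f i zero = 0
prefersAtMost f i (suc k) = b2n (at f k ≤ᵇ i) + prefersAtMost f i k

prefersAtMost-∷ : ∀ x g i k → prefersAtMost (x ∷ g) i (suc k) ≡ b2n (x ≤ᵇ i) + prefersAtMost g i k
prefersAtMost-∷ x g i zero = refl
prefersAtMost-∷ x g i (suc k) = begin
  b2n (at g k ≤ᵇ i) + prefersAtMost (x ∷ g) i (suc k)    ≡⟨ cong (b2n (at g k ≤ᵇ i) +_) (prefersAtMost-∷ x g i k) ⟩
  b2n (at g k ≤ᵇ i) + (b2n (x ≤ᵇ i) + prefersAtMost g i k) ≡⟨ x∙yz≈y∙xz +-commutativeSemigroup (b2n (at g k ≤ᵇ i)) (b2n (x ≤ᵇ i)) _ ⟩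
  b2n (x ≤ᵇ i) + (b2n (at g k ≤ᵇ i) + prefersAtMost g i k) ∎
  where open ≡-Reasoning

count-≤ᵇ≡prefersAtMost : ∀ f i → count (λ v → v ≤ᵇ i) f ≡ prefersAtMost f i (length f)
count-≤ᵇ≡prefersAtMost [] i = refl
count-≤ᵇ≡prefersAtMost (x ∷ g) i = trans (split (x ≤ᵇ i)) (sym (prefersAtMost-∷ x g i (length g)))
  where
  split : (b : Bool) → (if b then suc (count (λ v → v ≤ᵇ i) g) else count (λ v → v ≤ᵇ i) g) ≡ b2n b + prefersAtMost g i (length g)
  split true = cong suc (count-≤ᵇ≡prefersAtMost g i)
  split false = count-≤ᵇ≡prefersAtMost g i

drop-at : ∀ xs k → suc k ≤ length xs → drop k xs ≡ at xs k ∷ drop (suc k) xs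
drop-at (x ∷ xs) zero _ = refl
drop-at (x ∷ xs) (suc k) (s≤s le) = drop-at xs k le

InRange : ℕ → ℕ → Set
InRange n x = 1 ≤ x × x ≤ n

record IsPermutation (n : ℕ) (π : List ℕ) : Set where
  field
    length≡ : length π ≡ n
    inRange : All (InRange n) π
    distinct : Unique π

  at-inRange : ∀ i → i < n → 0 < at π i × at π i ≤ n
  at-inRange i lt = All-at inRange i (subst (i <_) (sym length≡) lt)

  at-injective : ∀ i j → i < n → j < n → at π i ≡ at π j → i ≡ j
  at-injective i j li lj = Unique⇒at-injective π distinct i j (subst (i <_) (sym length≡) li) (subst (j <_) (sym length≡) lj)

-- Car k+1 sits in spot q+1, which is at or after its preferred spot, and every
-- spot from the preferred one up to spot q is held by one of the cars 1..k.
ParksAs : ℕ → List ℕ → List ℕ → Set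
ParksAs n f π = ∀ k → k < n → ∃ λ q → q < n × at π q ≡ suc k × at f k ≤ suc q ×
  (∀ j → j < q → at f k ≤ suc j → 0 < at π j × at π j ≤ k)

mask : ℕ → List ℕ → List ℕ
mask k π = map (λ v → if v ≤ᵇ k then v else 0) π

at-mask : ∀ k π i → at (mask k π) i ≡ (if at π i ≤ᵇ k then at π i else 0)
at-mask k [] i = refl
at-mask k (x ∷ π) zero = refl
at-mask k (x ∷ π) (suc i) = at-mask k π i

module Parking (n : ℕ) (f : List ℕ) where

  street : ℕ → List ℕ
  street zero = replicate n 0
  street (suc k) = placeFrom 1 (at f k) (suc k) (street k)

  length-street : ∀ k → length (street k) ≡ n
  length-street zero = length-replicate n
  length-street (suc k) = trans (length-placeFrom 1 (at f k) (suc k) (street k)) (length-street k)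

  parkCars-resume : ∀ k → k ≤ length f → parkCars (suc k) (drop k f) (street k) ≡ parkingPermutation n f
  parkCars-resume zero _ = refl
  parkCars-resume (suc k) le = trans
    (cong (λ cars → parkCars (suc k) cars (street k)) (sym (drop-at f k le)))
    (parkCars-resume k (≤-trans (n≤1+n k) le))

  parkingPermutation≡street : parkingPermutation n f ≡ street (length f)
  parkingPermutation≡street = trans
    (sym (parkCars-resume (length f) ≤-refl))
    (cong (λ cars → parkCars (suc (length f)) cars (street (length f))) (drop-all (length f) f ≤-refl))

  street-≤ : ∀ k i → at (street k) i ≤ k
  street-≤ zero i = ≤-reflexive (at-replicate-0 n i)
  street-≤ (suc k) i with placement 1 (at f k) (suc k) (street k)
  ... | noFreeSpot eq _ = subst (λ xs → at xs i ≤ suc k) (sym eq) (m≤n⇒m≤1+n (street-≤ k i))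
  ... | parksAt q _ _ _ _ eq = subst (λ xs → at xs i ≤ suc k) (sym eq)
          (at-setAt-≤ (street k) q (suc k) i (suc k) (λ j → m≤n⇒m≤1+n (street-≤ k j)) ≤-refl)

  street-stable-step : ∀ k i → at (street k) i ≢ 0 → at (street (suc k)) i ≡ at (street k) i
  street-stable-step k i nz with placement 1 (at f k) (suc k) (street k)
  ... | noFreeSpot eq _ = cong (λ xs → at xs i) eq
  ... | parksAt q _ _ z _ eq with i ≟ q
  ...   | yes refl = ⊥-elim (nz z)
  ...   | no ne = trans (cong (λ xs → at xs i) eq) (at-setAt-≢ (street k) q (suc k) i ne)

  street-stable : ∀ k d i → at (street k) i ≢ 0 → at (street (d + k)) i ≡ at (street k) i
  street-stable k zero i nz = refl
  street-stable k (suc d) i nz =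
    trans (street-stable-step (d + k) i (λ e → nz (trans (sym (street-stable k d i nz)) e))) (street-stable k d i nz)

  street-stable-≤ : ∀ k m i → k ≤ m → at (street k) i ≢ 0 → at (street m) i ≡ at (street k) i
  street-stable-≤ k m i le nz = subst (λ m → at (street m) i ≡ at (street k) i) (m∸n+n≡m le) (street-stable k (m ∸ k) i nz)

  street-injective : ∀ k i j → at (street k) i ≡ at (street k) j → at (street k) i ≢ 0 → i ≡ j
  street-injective zero i j e nz = ⊥-elim (nz (at-replicate-0 n i))
  street-injective (suc k) i j e nz with placement 1 (at f k) (suc k) (street k)
  ... | noFreeSpot eq _ = street-injective k i j (subst (λ xs → at xs i ≡ at xs j) eq e) (subst (λ xs → at xs i ≢ 0) eq nz)
  ... | parksAt q lt _ _ _ eq = afterSet (subst (λ xs → at xs i ≡ at xs j) eq e) (subst (λ xs → at xs i ≢ 0) eq nz)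
    where
    new : at (setAt (street k) q (suc k)) q ≡ suc k
    new = at-setAt-≡ (street k) q (suc k) lt
    old : ∀ j → j ≢ q → at (setAt (street k) q (suc k)) j ≡ at (street k) j
    old = at-setAt-≢ (street k) q (suc k)
    afterSet : at (setAt (street k) q (suc k)) i ≡ at (setAt (street k) q (suc k)) j →
               at (setAt (street k) q (suc k)) i ≢ 0 → i ≡ j
    afterSet e′ nz′ with i ≟ q | j ≟ q
    ... | yes refl | yes refl = refl
    ... | yes refl | no nj = ⊥-elim (1+n≰n (subst (_≤ k) (trans (sym (old j nj)) (trans (sym e′) new)) (street-≤ k j)))
    ... | no ni | yes refl = ⊥-elim (1+n≰n (subst (_≤ k) (trans (sym (old i ni)) (trans e′ new)) (street-≤ k i)))
    ... | no ni | no nj = street-injective k i j (trans (sym (old i ni)) (trans e′ (old j nj))) (λ z → nz′ (trans (old i ni) z))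

  occupied-≤-prefersAtMost : ∀ i k → countOccupied (take i (street k)) ≤ prefersAtMost f i k
  occupied-≤-prefersAtMost i zero = ≤-reflexive (countOccupied-take-replicate-0 i n)
  occupied-≤-prefersAtMost i (suc k) with placement 1 (at f k) (suc k) (street k)
  ... | noFreeSpot eq _ = subst (λ xs → countOccupied (take i xs) ≤ prefersAtMost f i (suc k)) (sym eq)
          (≤-trans (occupied-≤-prefersAtMost i k) (m≤n+m _ _))
  ... | parksAt q lt le z h eq with q <? i
  ...   | yes qi = subst (λ xs → countOccupied (take i xs) ≤ prefersAtMost f i (suc k)) (sym eq)
            (subst (_≤ prefersAtMost f i (suc k)) (sym (countOccupied-take-fill (street k) q k i qi z lt))
              (subst (λ b → suc (countOccupied (take i (street k))) ≤ b2n b + prefersAtMost f i k)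
                (sym (≤ᵇ-true (≤-trans le qi))) (s≤s (occupied-≤-prefersAtMost i k))))
  ...   | no nqi = subst (λ xs → countOccupied (take i xs) ≤ prefersAtMost f i (suc k)) (sym eq)
            (subst (_≤ prefersAtMost f i (suc k)) (cong countOccupied (sym (take-setAt-beyond (street k) q (suc k) i (≮⇒≥ nqi))))
              (≤-trans (occupied-≤-prefersAtMost i k) (m≤n+m _ _)))

  Full : Set
  Full = ∀ i → i < n → at (street n) i ≢ 0

  module _ (length-f : length f ≡ n) where

    prefersAtMost≡count : ∀ i → prefersAtMost f i n ≡ count (λ v → v ≤ᵇ i) f
    prefersAtMost≡count i = sym (trans (count-≤ᵇ≡prefersAtMost f i) (cong (prefersAtMost f i) length-f))

    full⇒parking : Full → isParkingFunction n f ≡ true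
    full⇒parking full = allB-range⁺ 1 n λ i le lt → ≤ᵇ-true (subst (i ≤_) (prefersAtMost≡count i)
      (subst (_≤ prefersAtMost f i n)
        (countOccupied-take-full (street n) i (λ k lt′ → full k (subst (k <_) (length-street n) lt′))
          (subst (i ≤_) (sym (length-street n)) (s≤s⁻¹ lt)))
        (occupied-≤-prefersAtMost i n)))

    -- If spot i+1 stays empty, every car preferring a spot ≤ i+1 parked among spots 1..i.
    parking⇒full : isParkingFunction n f ≡ true → Full
    parking⇒full pf i lt empty = <⇒≱ (s≤s (≤-trans (fewPrefer n ≤-refl) (countOccupied-take-≤ (street n) i))) manyPrefer
      where
      manyPrefer : suc i ≤ prefersAtMost f (suc i) n
      manyPrefer = subst (suc i ≤_) (sym (prefersAtMost≡count (suc i)))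
        (≤ᵇ-sound (allB-range⁻ 1 n pf (suc i) (s≤s z≤n) (s≤s lt)))
      emptyThroughout : ∀ k → k ≤ n → at (street k) i ≡ 0
      emptyThroughout k le with at (street k) i ≟ 0
      ... | yes z = z
      ... | no nz = ⊥-elim (nz (trans (sym (street-stable-≤ k n i le nz)) empty))
      fewPrefer : ∀ k → k ≤ n → prefersAtMost f (suc i) k ≤ countOccupied (take i (street k))
      fewPrefer zero _ = z≤n
      fewPrefer (suc k) le with placement 1 (at f k) (suc k) (street k) | at f k ≤ᵇ suc i in e
      ... | noFreeSpot eq h | true = ⊥-elim (h i (subst (i <_) (sym (length-street k)) lt) (≤ᵇ-sound e) (emptyThroughout k (≤-trans (n≤1+n k) le)))
      ... | noFreeSpot eq h | false = subst (λ xs → prefersAtMost f (suc i) k ≤ countOccupied (take i xs)) (sym eq)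
              (fewPrefer k (≤-trans (n≤1+n k) le))
      ... | parksAt q lq _ z h eq | false = subst (λ xs → prefersAtMost f (suc i) k ≤ countOccupied (take i xs)) (sym eq)
              (≤-trans (fewPrefer k (≤-trans (n≤1+n k) le)) (countOccupied-take-fill-≤ (street k) q k i z lq))
      ... | parksAt q lq _ z h eq | true with <-cmp q i
      ...   | tri< qi _ _ = subst (λ xs → suc (prefersAtMost f (suc i) k) ≤ countOccupied (take i xs)) (sym eq)
                (subst (suc (prefersAtMost f (suc i) k) ≤_) (sym (countOccupied-take-fill (street k) q k i qi z lq))
                  (s≤s (fewPrefer k (≤-trans (n≤1+n k) le))))
      ...   | tri≈ _ refl _ = ⊥-elim (0≢1+n (trans (sym (emptyThroughout (suc k) le))
                (trans (cong (λ xs → at xs q) eq) (at-setAt-≡ (street k) q (suc k) lq))))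
      ...   | tri> _ _ iq = ⊥-elim (h i iq (≤ᵇ-sound e) (emptyThroughout k (≤-trans (n≤1+n k) le)))

  occupied-step : ∀ k → countOccupied (take n (street (suc k))) ≤ suc (countOccupied (take n (street k)))
  occupied-step k with placement 1 (at f k) (suc k) (street k)
  ... | noFreeSpot eq _ = subst (λ xs → countOccupied (take n xs) ≤ suc (countOccupied (take n (street k)))) (sym eq) (n≤1+n _)
  ... | parksAt q lq _ z _ eq = subst (λ xs → countOccupied (take n xs) ≤ suc (countOccupied (take n (street k)))) (sym eq)
          (≤-reflexive (countOccupied-take-fill (street k) q k n (subst (q <_) (length-street k) lq) z lq))

  occupied-steps : ∀ k d → countOccupied (take n (street (d + k))) ≤ d + countOccupied (take n (street k))
  occupied-steps k zero = ≤-refl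
  occupied-steps k (suc d) = ≤-trans (occupied-step (d + k)) (s≤s (occupied-steps k d))

  occupied-≤-cars : ∀ k → countOccupied (take n (street k)) ≤ k
  occupied-≤-cars k = subst (λ m → countOccupied (take n (street m)) ≤ m) (+-identityʳ k)
    (≤-trans (occupied-steps 0 k) (≤-reflexive (cong (k +_) (countOccupied-take-replicate-0 n n))))

  module _ (full : Full) where

    -- A car finding no free spot would leave fewer than n spots occupied at the end.
    everyCarParks : ∀ k → k < n → ∃ λ q → q < n × at f k ≤ suc q × at (street k) q ≡ 0 ×
        (∀ j → j < q → at f k ≤ suc j → at (street k) j ≢ 0) × street (suc k) ≡ setAt (street k) q (suc k)
    everyCarParks k lt with placement 1 (at f k) (suc k) (street k)
    ... | parksAt q lq le z h eq = q , subst (q <_) (length-street k) lq , le , z , h , eq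
    ... | noFreeSpot eq _ = ⊥-elim (<⇒≱ tooFew (≤-reflexive (sym allOccupied)))
      where
      allOccupied : countOccupied (take n (street n)) ≡ n
      allOccupied = countOccupied-take-full (street n) n (λ k lt → full k (subst (k <_) (length-street n) lt)) (≤-reflexive (sym (length-street n)))
      remaining : n ∸ suc k + suc k ≡ n
      remaining = m∸n+n≡m lt
      tooFew : countOccupied (take n (street n)) < n
      tooFew = subst (λ m → countOccupied (take n (street m)) < n) remaining
        (≤-trans (s≤s (occupied-steps (suc k) (n ∸ suc k)))
          (subst (λ xs → suc (n ∸ suc k + countOccupied (take n xs)) ≤ n) (sym eq)
            (≤-trans (s≤s (+-monoʳ-≤ (n ∸ suc k) (occupied-≤-cars k))) (≤-reflexive (trans (sym (+-suc (n ∸ suc k) k)) remaining)))))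

    full⇒parksAs : ParksAs n f (street n)
    full⇒parksAs k lt with everyCarParks k lt
    ... | q , lq , le , z , h , eq = q , lq , staysAt , le , λ j jq lej → earlierCar j jq lej
      where
      justParked : at (street (suc k)) q ≡ suc k
      justParked = trans (cong (λ xs → at xs q) eq) (at-setAt-≡ (street k) q (suc k) (subst (q <_) (sym (length-street k)) lq))
      staysAt : at (street n) q ≡ suc k
      staysAt = trans (street-stable-≤ (suc k) n q lt (λ e → 0≢1+n (trans (sym e) justParked))) justParked
      earlierCar : ∀ j → j < q → at f k ≤ suc j → 0 < at (street n) j × at (street n) j ≤ k
      earlierCar j jq lej = subst (λ v → 0 < v × v ≤ k) (sym (street-stable-≤ k n j (≤-trans (n≤1+n k) lt) (h j jq lej)))
        (n≢0⇒n>0 (h j jq lej) , street-≤ k j)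

  -- Conversely, if f parks as a permutation π then after k cars the street shows
  -- exactly the cars of π numbered ≤ k.
  module _ (π : List ℕ) (length-π : length π ≡ n) (inRange : ∀ i → i < n → 0 < at π i × at π i ≤ n)
           (injective : ∀ i j → i < n → j < n → at π i ≡ at π j → i ≡ j) (parks : ParksAs n f π) where

    street≡mask : ∀ k → k ≤ n → street k ≡ mask k π
    street≡mask zero _ = at-extensionality _ _ (trans (length-replicate n) (sym (trans (length-map _ π) length-π)))
      λ i lt → trans (at-replicate-0 n i) (sym (trans (at-mask 0 π i) (noneYet i (subst (i <_) (length-replicate n) lt))))
      where
      noneYet : ∀ i → i < n → (if at π i ≤ᵇ 0 then at π i else 0) ≡ 0
      noneYet i lt rewrite ≤ᵇ-false {at π i} {0} (proj₁ (inRange i lt)) = refl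
    street≡mask (suc k) le with parks k le
    ... | q , lq , πq , pq , hq = trans (cong (placeFrom 1 (at f k) (suc k)) (street≡mask k (≤-trans (n≤1+n k) le)))
          (trans (placeFrom-firstFree 1 (at f k) (suc k) (mask k π) q lqm pq free blocked) revealed)
      where
      lqm : q < length (mask k π)
      lqm = subst (q <_) (sym (trans (length-map _ π) length-π)) lq
      free : at (mask k π) q ≡ 0
      free rewrite at-mask k π q | πq | ≤ᵇ-false {suc k} {k} ≤-refl = refl
      blocked : ∀ j → j < q → at f k ≤ suc j → at (mask k π) j ≢ 0
      blocked j jq lej with hq j jq lej
      ... | pos , lek rewrite at-mask k π j | ≤ᵇ-true lek = λ e → <⇒≢ pos (sym e)
      revealedAt : ∀ i → i < n → at (setAt (mask k π) q (suc k)) i ≡ at (mask (suc k) π) i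
      revealedAt i lt with i ≟ q
      ... | yes refl rewrite at-setAt-≡ (mask k π) q (suc k) lqm | at-mask (suc k) π q | πq | ≤ᵇ-true (≤-refl {suc k}) = refl
      ... | no ne rewrite at-setAt-≢ (mask k π) q (suc k) i ne | at-mask k π i | at-mask (suc k) π i = unchanged
        where
        notNew : at π i ≢ suc k
        notNew e = ne (injective i q lt lq (trans e (sym πq)))
        unchanged : (if at π i ≤ᵇ k then at π i else 0) ≡ (if at π i ≤ᵇ suc k then at π i else 0)
        unchanged with at π i ≤? k
        ... | yes a rewrite ≤ᵇ-true a | ≤ᵇ-true (m≤n⇒m≤1+n a) = refl
        ... | no a rewrite ≤ᵇ-false (≰⇒> a) | ≤ᵇ-false {at π i} {suc k} (≤∧≢⇒< (≰⇒> a) (λ e → notNew (sym e))) = refl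
      revealed : setAt (mask k π) q (suc k) ≡ mask (suc k) π
      revealed = at-extensionality _ _ (trans (length-setAt (mask k π) q (suc k)) (trans (length-map _ π) (sym (length-map _ π))))
        λ i lt → revealedAt i (subst (i <_) (trans (length-setAt (mask k π) q (suc k)) (trans (length-map _ π) length-π)) lt)

    mask-all : mask n π ≡ π
    mask-all = at-extensionality _ _ (length-map _ π) λ i lt → trans (at-mask n π i) (keep i (subst (i <_) (trans (length-map _ π) length-π) lt))
      where
      keep : ∀ i → i < n → (if at π i ≤ᵇ n then at π i else 0) ≡ at π i
      keep i lt rewrite ≤ᵇ-true (proj₂ (inRange i lt)) = refl

    street≡π : street n ≡ π
    street≡π = trans (street≡mask n ≤-refl) mask-all

    parksAs⇒full : Full
    parksAs⇒full i lt e = <⇒≢ (proj₁ (inRange i lt)) (sym (trans (sym (cong (λ xs → at xs i) street≡π)) e))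

module _ {n : ℕ} (f : List ℕ) (length-f : length f ≡ n) where
  open Parking n f

  street-n≡parkingPermutation : street n ≡ parkingPermutation n f
  street-n≡parkingPermutation = sym (trans parkingPermutation≡street (cong street length-f))

  module _ (pf : isParkingFunction n f ≡ true) where

    parkingPermutation-isPermutation : IsPermutation n (parkingPermutation n f)
    parkingPermutation-isPermutation = subst (IsPermutation n) street-n≡parkingPermutation record
      { length≡ = length-street n
      ; inRange = at⇒All (street n) λ q lq → n≢0⇒n>0 (full q (shrink lq)) , street-≤ n q
      ; distinct = at-injective⇒Unique (street n) λ i j li lj e → street-injective n i j e (full i (shrink li))
      }
      where
      full : Full
      full = parking⇒full length-f pf
      shrink : ∀ {q} → q < length (street n) → q < n
      shrink {q} = subst (q <_) (length-street n)

    parking⇒parksAs : ParksAs n f (parkingPermutation n f)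
    parking⇒parksAs = subst (ParksAs n f) street-n≡parkingPermutation (full⇒parksAs (parking⇒full length-f pf))

  module _ {π : List ℕ} (perm : IsPermutation n π) (parks : ParksAs n f π) where
    open IsPermutation perm

    parksAs⇒parkingPermutation : parkingPermutation n f ≡ π
    parksAs⇒parkingPermutation = trans (sym street-n≡parkingPermutation) (street≡π π length≡ at-inRange at-injective parks)

    parksAs⇒parking : isParkingFunction n f ≡ true
    parksAs⇒parking = full⇒parking length-f (parksAs⇒full π length≡ at-inRange at-injective parks)

-- Pattern containment

Occurs : (ℕ → ℕ → ℕ → Set) → List ℕ → Set
Occurs P π = ∃ λ a → ∃ λ b → ∃ λ c → (a ∷ b ∷ c ∷ []) ⊆ π × P a b c

Is123 Is231 Is312 : ℕ → ℕ → ℕ → Set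
Is123 a b c = a < b × b < c
Is231 a b c = c < a × a < b
Is312 a b c = b < c × c < a

anyB-++ : ∀ {A : Set} (p : A → Bool) xs ys → anyB p (xs ++ ys) ≡ (anyB p xs ∨ anyB p ys)
anyB-++ p [] ys = refl
anyB-++ p (x ∷ xs) ys rewrite anyB-++ p xs ys = sym (∨-assoc (p x) (anyB p xs) (anyB p ys))

anyB-map : ∀ {A B : Set} (p : B → Bool) (g : A → B) xs → anyB p (map g xs) ≡ anyB (λ x → p (g x)) xs
anyB-map p g [] = refl
anyB-map p g (x ∷ xs) rewrite anyB-map p g xs = refl

∨-true⁻ : ∀ a b → (a ∨ b) ≡ true → a ≡ true ⊎ b ≡ true
∨-true⁻ true b e = inj₁ refl
∨-true⁻ false b e = inj₂ e

∨-trueˡ : ∀ a b → a ≡ true → (a ∨ b) ≡ true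
∨-trueˡ true b _ = refl

∨-trueʳ : ∀ a b → b ≡ true → (a ∨ b) ≡ true
∨-trueʳ true b _ = refl
∨-trueʳ false b e = e

anyB-subseqs⁻ : ∀ (p : List ℕ → Bool) m xs → anyB p (subseqs m xs) ≡ true →
  ∃ λ s → s ⊆ xs × length s ≡ m × p s ≡ true
anyB-subseqs⁻ p zero xs e with p [] in e′
... | true = [] , minimum xs , refl , e′
anyB-subseqs⁻ p (suc m) (x ∷ xs) e
  with ∨-true⁻ _ _ (trans (sym (anyB-++ p (map (x ∷_) (subseqs m xs)) (subseqs (suc m) xs))) e)
... | inj₁ e₁ with anyB-subseqs⁻ (λ s → p (x ∷ s)) m xs (trans (sym (anyB-map p (x ∷_) (subseqs m xs))) e₁)
...   | s , s⊆ , len , ps = x ∷ s , refl ∷ s⊆ , cong suc len , ps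
anyB-subseqs⁻ p (suc m) (x ∷ xs) e | inj₂ e₂ with anyB-subseqs⁻ p (suc m) xs e₂
...   | s , s⊆ , len , ps = s , x ∷ʳ s⊆ , len , ps

anyB-subseqs⁺ : ∀ (p : List ℕ → Bool) s xs → s ⊆ xs → p s ≡ true → anyB p (subseqs (length s) xs) ≡ true
anyB-subseqs⁺ p [] xs _ e rewrite e = refl
anyB-subseqs⁺ p (z ∷ zs) (y ∷ ys) (.y ∷ʳ s⊆) e =
  trans (anyB-++ p (map (y ∷_) (subseqs (length zs) ys)) (subseqs (suc (length zs)) ys))
    (∨-trueʳ _ _ (anyB-subseqs⁺ p (z ∷ zs) ys s⊆ e))
anyB-subseqs⁺ p (y ∷ zs) (y ∷ ys) (refl ∷ s⊆) e =
  trans (anyB-++ p (map (y ∷_) (subseqs (length zs) ys)) (subseqs (suc (length zs)) ys))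
    (∨-trueˡ _ _ (trans (anyB-map p (y ∷_) (subseqs (length zs) ys)) (anyB-subseqs⁺ (λ s → p (y ∷ s)) zs ys s⊆ e)))

containsPattern⇔Occurs : ∀ x y z (P : ℕ → ℕ → ℕ → Set) →
  (∀ a b c → orderIso (x ∷ y ∷ z ∷ []) (a ∷ b ∷ c ∷ []) ≡ true ⇔ P a b c) →
  ∀ π → containsPattern π (x ∷ y ∷ z ∷ []) ≡ true ⇔ Occurs P π
containsPattern⇔Occurs x y z P decode π = mk⇔ found build
  where
  found : containsPattern π (x ∷ y ∷ z ∷ []) ≡ true → Occurs P π
  found e with anyB-subseqs⁻ (orderIso (x ∷ y ∷ z ∷ [])) 3 π e
  ... | a ∷ b ∷ c ∷ [] , s⊆ , _ , iso = a , b , c , s⊆ , Equivalence.to (decode a b c) iso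
  build : Occurs P π → containsPattern π (x ∷ y ∷ z ∷ []) ≡ true
  build (a , b , c , s⊆ , p) = anyB-subseqs⁺ _ (a ∷ b ∷ c ∷ []) π s⊆ (Equivalence.from (decode a b c) p)

<ᵇ-irrefl : ∀ a → (a <ᵇ a) ≡ false
<ᵇ-irrefl a = <ᵇ-false {a} {a} ≤-refl

false≢true : false ≢ true
false≢true ()

orderIso-123 : ∀ a b c → orderIso (1 ∷ 2 ∷ 3 ∷ []) (a ∷ b ∷ c ∷ []) ≡ true ⇔ Is123 a b c
orderIso-123 a b c = mk⇔ decode encode
  where
  decode : orderIso (1 ∷ 2 ∷ 3 ∷ []) (a ∷ b ∷ c ∷ []) ≡ true → Is123 a b c
  decode e rewrite <ᵇ-irrefl a | <ᵇ-irrefl b | <ᵇ-irrefl c with a <ᵇ b in ab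
  ... | false = ⊥-elim (false≢true e)
  ... | true with a <ᵇ c
  ...   | false = ⊥-elim (false≢true e)
  ...   | true with b <ᵇ a
  ...     | true = ⊥-elim (false≢true e)
  ...     | false with b <ᵇ c in bc
  ...       | false = ⊥-elim (false≢true e)
  ...       | true = <ᵇ-sound ab , <ᵇ-sound bc
  encode : Is123 a b c → orderIso (1 ∷ 2 ∷ 3 ∷ []) (a ∷ b ∷ c ∷ []) ≡ true
  encode (a<b , b<c) rewrite <ᵇ-irrefl a | <ᵇ-irrefl b | <ᵇ-irrefl c | <ᵇ-true a<b | <ᵇ-true b<c | <ᵇ-true (<-trans a<b b<c)
    | <ᵇ-false (<⇒≤ a<b) | <ᵇ-false (<⇒≤ b<c) | <ᵇ-false (<⇒≤ (<-trans a<b b<c)) = refl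

orderIso-231 : ∀ a b c → orderIso (2 ∷ 3 ∷ 1 ∷ []) (a ∷ b ∷ c ∷ []) ≡ true ⇔ Is231 a b c
orderIso-231 a b c = mk⇔ decode encode
  where
  decode : orderIso (2 ∷ 3 ∷ 1 ∷ []) (a ∷ b ∷ c ∷ []) ≡ true → Is231 a b c
  decode e rewrite <ᵇ-irrefl a | <ᵇ-irrefl b | <ᵇ-irrefl c with a <ᵇ b in ab
  ... | false = ⊥-elim (false≢true e)
  ... | true with a <ᵇ c
  ...   | true = ⊥-elim (false≢true e)
  ...   | false with b <ᵇ a
  ...     | true = ⊥-elim (false≢true e)
  ...     | false with b <ᵇ c
  ...       | true = ⊥-elim (false≢true e)
  ...       | false with c <ᵇ a in ca
  ...         | false = ⊥-elim (false≢true e)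
  ...         | true = <ᵇ-sound ca , <ᵇ-sound ab
  encode : Is231 a b c → orderIso (2 ∷ 3 ∷ 1 ∷ []) (a ∷ b ∷ c ∷ []) ≡ true
  encode (c<a , a<b) rewrite <ᵇ-irrefl a | <ᵇ-irrefl b | <ᵇ-irrefl c | <ᵇ-true a<b | <ᵇ-true c<a | <ᵇ-true (<-trans c<a a<b)
    | <ᵇ-false (<⇒≤ a<b) | <ᵇ-false (<⇒≤ c<a) | <ᵇ-false (<⇒≤ (<-trans c<a a<b)) = refl

orderIso-312 : ∀ a b c → orderIso (3 ∷ 1 ∷ 2 ∷ []) (a ∷ b ∷ c ∷ []) ≡ true ⇔ Is312 a b c
orderIso-312 a b c = mk⇔ decode encode
  where
  decode : orderIso (3 ∷ 1 ∷ 2 ∷ []) (a ∷ b ∷ c ∷ []) ≡ true → Is312 a b c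
  decode e rewrite <ᵇ-irrefl a | <ᵇ-irrefl b | <ᵇ-irrefl c with a <ᵇ b
  ... | true = ⊥-elim (false≢true e)
  ... | false with a <ᵇ c
  ...   | true = ⊥-elim (false≢true e)
  ...   | false with b <ᵇ a
  ...     | false = ⊥-elim (false≢true e)
  ...     | true with b <ᵇ c in bc
  ...       | false = ⊥-elim (false≢true e)
  ...       | true with c <ᵇ a in ca
  ...         | false = ⊥-elim (false≢true e)
  ...         | true = <ᵇ-sound bc , <ᵇ-sound ca
  encode : Is312 a b c → orderIso (3 ∷ 1 ∷ 2 ∷ []) (a ∷ b ∷ c ∷ []) ≡ true
  encode (b<c , c<a) rewrite <ᵇ-irrefl a | <ᵇ-irrefl b | <ᵇ-irrefl c | <ᵇ-true b<c | <ᵇ-true c<a | <ᵇ-true (<-trans b<c c<a)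
    | <ᵇ-false (<⇒≤ b<c) | <ᵇ-false (<⇒≤ c<a) | <ᵇ-false (<⇒≤ (<-trans b<c c<a)) = refl

not-true⇒false : ∀ {b} → not b ≡ true → b ≡ false
not-true⇒false {false} _ = refl

false⇒not-true : ∀ {b} → ¬ (b ≡ true) → not b ≡ true
false⇒not-true {true} h = ⊥-elim (h refl)
false⇒not-true {false} _ = refl

-- avoidsAll π [σ , τ] unfolds to not (contains σ) ∧ (not (contains τ) ∧ true).
avoidsBoth⇔ : ∀ π σ τ (P Q : ℕ → ℕ → ℕ → Set) →
  (containsPattern π σ ≡ true ⇔ Occurs P π) → (containsPattern π τ ≡ true ⇔ Occurs Q π) →
  avoidsAll π (σ ∷ τ ∷ []) ≡ true ⇔ (¬ Occurs P π × ¬ Occurs Q π)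
avoidsBoth⇔ π σ τ P Q σ⇔ τ⇔ = mk⇔
  (λ e → notOccurs σ σ⇔ (∧-trueˡ e) , notOccurs τ τ⇔ (∧-trueˡ (∧-trueʳ {not (containsPattern π σ)} e)))
  (λ (¬P , ¬Q) → cong₂ _∧_ (avoids σ σ⇔ ¬P) (cong (_∧ true) (avoids τ τ⇔ ¬Q)))
  where
  notOccurs : ∀ ρ {R} → (containsPattern π ρ ≡ true ⇔ Occurs R π) → not (containsPattern π ρ) ≡ true → ¬ Occurs R π
  notOccurs ρ ρ⇔ e occ = true≢false (trans (sym (Equivalence.from ρ⇔ occ)) (not-true⇒false e))
  avoids : ∀ ρ {R} → (containsPattern π ρ ≡ true ⇔ Occurs R π) → ¬ Occurs R π → not (containsPattern π ρ) ≡ true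
  avoids ρ ρ⇔ ¬R = false⇒not-true (λ e → ¬R (Equivalence.to ρ⇔ e))

-- Permutations avoiding {123, 231} or {123, 312}

Decreasing : List ℕ → Set
Decreasing = AllPairs _>_

_≫_ : List ℕ → List ℕ → Set
xs ≫ ys = All (λ x → All (x >_) ys) xs

≫-++ : ∀ {xs ys zs} → xs ≫ ys → xs ≫ zs → xs ≫ (ys ++ zs)
≫-++ p q = All.zipWith (λ (a , b) → Allₚ.++⁺ a b) (p , q)

AllPairs-⊆ : ∀ {R : ℕ → ℕ → Set} {xs ys} → xs ⊆ ys → AllPairs R ys → AllPairs R xs
AllPairs-⊆ [] [] = []
AllPairs-⊆ (_ ∷ʳ s) (_ ∷ p) = AllPairs-⊆ s p
AllPairs-⊆ (refl ∷ s) (r ∷ p) = Sublistₚ.All-resp-⊆ s r ∷ AllPairs-⊆ s p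

AllPairs-pair : ∀ {R : ℕ → ℕ → Set} {xs a b} → AllPairs R xs → (a ∷ b ∷ []) ⊆ xs → R a b
AllPairs-pair (_ ∷ p) (_ ∷ʳ s) = AllPairs-pair p s
AllPairs-pair (r ∷ p) (refl ∷ s) = All.lookup r (to∈ s)

All-swap : ∀ {R : ℕ → ℕ → Set} {xs ys} → All (λ x → All (R x) ys) xs → All (λ y → All (λ x → R x y) xs) ys
All-swap h = All.tabulate λ iy → All.tabulate λ ix → All.lookup (All.lookup h ix) iy

All-++-comm : ∀ {P : ℕ → Set} xs {ys} → All P (xs ++ ys) → All P (ys ++ xs)
All-++-comm xs a = Allₚ.++⁺ (Allₚ.++⁻ʳ xs a) (Allₚ.++⁻ˡ xs a)

Decreasing-++⁻ : ∀ xs {ys} → Decreasing (xs ++ ys) → xs ≫ ys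
Decreasing-++⁻ [] _ = []
Decreasing-++⁻ (x ∷ xs) (r ∷ d) = Allₚ.++⁻ʳ xs r ∷ Decreasing-++⁻ xs d

Decreasing-⊆-pair : ∀ {xs a b} → Decreasing xs → a ∈ xs → b ∈ xs → b < a → (a ∷ b ∷ []) ⊆ xs
Decreasing-⊆-pair (r ∷ d) (here refl) (here refl) b<a = ⊥-elim (<-irrefl refl b<a)
Decreasing-⊆-pair (r ∷ d) (here refl) (there ib) b<a = refl ∷ from∈ ib
Decreasing-⊆-pair (r ∷ d) (there ia) (here refl) b<a = ⊥-elim (<-asym b<a (All.lookup r ia))
Decreasing-⊆-pair (r ∷ d) (there ia) (there ib) b<a = _ ∷ʳ Decreasing-⊆-pair d ia ib b<a

noAscent⇒Decreasing : ∀ {xs} → Unique xs → (∀ {a b} → (a ∷ b ∷ []) ⊆ xs → ¬ a < b) → Decreasing xs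
noAscent⇒Decreasing [] _ = []
noAscent⇒Decreasing (x∉ ∷ u) h =
  All.tabulate (λ iy → ≤∧≢⇒< (≮⇒≥ (h (refl ∷ from∈ iy))) (λ e → All.lookup x∉ iy (sym e)))
  ∷ noAscent⇒Decreasing u (λ s → h (_ ∷ʳ s))

splitAtMax : ∀ x xs → Unique (x ∷ xs) → ∃ λ P → ∃ λ m → ∃ λ S → x ∷ xs ≡ P ++ m ∷ S × All (_< m) P × All (_< m) S
splitAtMax x [] _ = [] , x , [] , refl , [] , []
splitAtMax x (y ∷ ys) (x∉ ∷ u) with splitAtMax y ys u
... | P , m , S , eq , P<m , S<m with x <? m
...   | yes x<m = x ∷ P , m , S , cong (x ∷_) eq , x<m ∷ P<m , S<m
...   | no x≮m = [] , x , y ∷ ys , refl , [] ,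
          subst (All (_< x)) (sym eq) (Allₚ.++⁺ (All.map (λ p → <-trans p m<x) P<m) (m<x ∷ All.map (λ s → <-trans s m<x) S<m))
  where
  m<x : m < x
  m<x = ≤∧≢⇒< (≮⇒≥ x≮m) (λ e → All.lookup x∉ (subst (m ∈_) (sym eq) (∈-++⁺ʳ P (here refl))) (sym e))

before-max-decreasing : ∀ P m S → Unique (P ++ m ∷ S) → All (_< m) P → ¬ Occurs Is123 (P ++ m ∷ S) → Decreasing P
before-max-decreasing P m S u P<m no123 = noAscent⇒Decreasing (AllPairs-⊆ (Sublistₚ.++⁺ʳ (m ∷ S) ⊆-refl) u) λ s a<b →
  no123 (_ , _ , m , Sublistₚ.++⁺ s (refl ∷ minimum S) , a<b , All.lookup P<m (Sublistₚ.Any-resp-⊆ s (there (here refl))))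

after-max-decreasing : ∀ P m S → Unique (P ++ m ∷ S) → All (_< m) S → ¬ Occurs Is312 (P ++ m ∷ S) → Decreasing S
after-max-decreasing P m S u S<m no312 = noAscent⇒Decreasing (AllPairs-⊆ (Sublistₚ.++⁺ˡ P (m ∷ʳ ⊆-refl)) u) λ s a<b →
  no312 (m , _ , _ , Sublistₚ.++⁺ˡ P (refl ∷ s) , a<b , All.lookup S<m (Sublistₚ.Any-resp-⊆ s (there (here refl))))

¬Occurs-subst : ∀ {P : ℕ → ℕ → ℕ → Set} {π ρ} → π ≡ ρ → ¬ Occurs P π → ¬ Occurs P ρ
¬Occurs-subst refl ¬occ = ¬occ

Shape₁ : List ℕ → Set
Shape₁ π = ∃ λ H → ∃ λ L → ∃ λ G → π ≡ H ++ L ++ G ×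
  Decreasing H × Decreasing L × Decreasing G × H ≫ (L ++ G) × G ≫ L

-- Split at the maximum m.  If something precedes m, then 231 forces everything
-- before m below everything after m, and 123 makes both sides decreasing.
avoiding123-231⇒Shape₁ : ∀ π → Unique π → ¬ Occurs Is123 π → ¬ Occurs Is231 π → Shape₁ π
avoiding123-231⇒Shape₁ [] _ _ _ = [] , [] , [] , refl , [] , [] , [] , [] , []
avoiding123-231⇒Shape₁ (x ∷ xs) u no123 no231 with splitAtMax x xs u
... | [] , .x , .xs , refl , _ , below with u
...   | _ ∷ u′ with avoiding123-231⇒Shape₁ xs u′ (λ (a , b , c , s , p) → no123 (a , b , c , x ∷ʳ s , p))
                                                 (λ (a , b , c , s , p) → no231 (a , b , c , x ∷ʳ s , p))
...     | H , L , G , refl , dH , dL , dG , H≫ , G≫L =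
          x ∷ H , L , G , refl , Allₚ.++⁻ˡ H below ∷ dH , dL , dG , Allₚ.++⁻ʳ H below ∷ H≫ , G≫L
avoiding123-231⇒Shape₁ (x ∷ xs) u no123 no231 | p ∷ P′ , m , S , eq , P<m , S<m =
  [] , P , m ∷ S , eq , [] , decreasingP , S<m ∷ decreasingS , [] , P<m ∷ S≫P
  where
  P = p ∷ P′
  u′ : Unique (P ++ m ∷ S)
  u′ = subst Unique eq u
  S≫P : S ≫ P
  S≫P = All.tabulate λ {c} c∈S → All.tabulate λ {a} a∈P →
    ≤∧≢⇒< (≮⇒≥ (λ c<a → ¬Occurs-subst eq no231 (a , m , c , Sublistₚ.++⁺ (from∈ a∈P) (refl ∷ from∈ c∈S) , c<a , All.lookup P<m a∈P)))
          (AllPairs-pair u′ (Sublistₚ.++⁺ (from∈ a∈P) (m ∷ʳ from∈ c∈S)))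
  decreasingP : Decreasing P
  decreasingP = before-max-decreasing P m S u′ P<m (¬Occurs-subst eq no123)
  decreasingS : Decreasing S
  decreasingS = noAscent⇒Decreasing (AllPairs-⊆ (Sublistₚ.++⁺ˡ P (m ∷ʳ ⊆-refl)) u′) λ s a<b →
    ¬Occurs-subst eq no123 (p , _ , _ , Sublistₚ.++⁺ (refl ∷ minimum P′) (m ∷ʳ s) ,
      All.lookup (All.lookup S≫P (Sublistₚ.Any-resp-⊆ s (here refl))) (here refl) , a<b)

Shape₂ : List ℕ → Set
Shape₂ π = ∃ λ M → ∃ λ T → ∃ λ B → π ≡ M ++ T ++ B ×
  Decreasing M × Decreasing T × Decreasing B × T ≫ M × M ≫ B × T ≫ B

splitAround : ∀ P S → Decreasing S → (∀ {s} → s ∈ S → All (_< s) P ⊎ All (s <_) P) →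
  ∃ λ T → ∃ λ B → S ≡ T ++ B × T ≫ P × All (λ b → All (b <_) P) B
splitAround P [] _ _ = [] , [] , refl , [] , []
splitAround P (s ∷ S) (r ∷ d) side with side (here refl)
... | inj₂ below = [] , s ∷ S , refl , [] , below ∷ All.map (λ s′<s → All.map (λ s<p → <-trans s′<s s<p) below) r
... | inj₁ above with splitAround P S d (λ i → side (there i))
...   | T , B , refl , T≫P , B≪P = s ∷ T , B , refl , above ∷ T≫P , B≪P

-- Otherwise two entries p₁ > s > p₂ of P (in this order, P decreasing) form 312 with s.
aboveOrBelow : ∀ P m S → Unique (P ++ m ∷ S) → Decreasing P → ¬ Occurs Is312 (P ++ m ∷ S) →
  ∀ {s} → s ∈ S → All (_< s) P ⊎ All (s <_) P
aboveOrBelow P m S u dP no312 {s} s∈S with All.all? (_<? s) P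
... | yes above = inj₁ above
... | no notAbove with All.all? (s <?_) P
...   | yes below = inj₂ below
...   | no notBelow with find (Allₚ.¬All⇒Any¬ (_<? s) P notAbove) | find (Allₚ.¬All⇒Any¬ (s <?_) P notBelow)
...     | p₁ , p₁∈P , s≮p₁ | p₂ , p₂∈P , p₂≮s =
          ⊥-elim (no312 (p₁ , p₂ , s , Sublistₚ.++⁺ (Decreasing-⊆-pair dP p₁∈P p₂∈P (<-trans p₂<s s<p₁)) (m ∷ʳ from∈ s∈S) , p₂<s , s<p₁))
  where
  s<p₁ : s < p₁
  s<p₁ = ≤∧≢⇒< (≮⇒≥ s≮p₁) (λ e → AllPairs-pair u (Sublistₚ.++⁺ (from∈ p₁∈P) (m ∷ʳ from∈ s∈S)) (sym e))
  p₂<s : p₂ < s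
  p₂<s = ≤∧≢⇒< (≮⇒≥ p₂≮s) (AllPairs-pair u (Sublistₚ.++⁺ (from∈ p₂∈P) (m ∷ʳ from∈ s∈S)))

-- Everything after the maximum m decreases (else 312 with m), and splits into a
-- part above and a part below everything before m.
Shape₂-aroundMax : ∀ P m S → Unique (P ++ m ∷ S) → All (_< m) P → All (_< m) S →
  ¬ Occurs Is123 (P ++ m ∷ S) → ¬ Occurs Is312 (P ++ m ∷ S) → Shape₂ (P ++ m ∷ S)
Shape₂-aroundMax P m S u P<m S<m no123 no312
  with splitAround P S (after-max-decreasing P m S u S<m no312)
         (aboveOrBelow P m S u (before-max-decreasing P m S u P<m no123) no312)
... | Hi , Lo , refl , Hi≫P , Lo≪P =
  P , m ∷ Hi , Lo , refl , before-max-decreasing P m S u P<m no123 ,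
  Allₚ.++⁻ˡ Hi S<m ∷ AllPairs-⊆ (Sublistₚ.++⁺ʳ Lo ⊆-refl) decreasingS ,
  AllPairs-⊆ (Sublistₚ.++⁺ˡ Hi ⊆-refl) decreasingS ,
  P<m ∷ Hi≫P , All-swap Lo≪P , Allₚ.++⁻ʳ Hi S<m ∷ Decreasing-++⁻ Hi decreasingS
  where
  decreasingS = after-max-decreasing P m (Hi ++ Lo) u S<m no312

avoiding123-312⇒Shape₂ : ∀ π → Unique π → ¬ Occurs Is123 π → ¬ Occurs Is312 π → Shape₂ π
avoiding123-312⇒Shape₂ [] _ _ _ = [] , [] , [] , refl , [] , [] , [] , [] , [] , []
avoiding123-312⇒Shape₂ (x ∷ xs) u no123 no312 with splitAtMax x xs u
... | P , m , S , eq , P<m , S<m = subst Shape₂ (sym eq)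
  (Shape₂-aroundMax P m S (subst Unique eq u) P<m S<m (¬Occurs-subst eq no123) (¬Occurs-subst eq no312))

descRun : ℕ → ℕ → List ℕ
descRun lo zero = []
descRun lo (suc k) = lo + k ∷ descRun lo k

length-descRun : ∀ lo k → length (descRun lo k) ≡ k
length-descRun lo zero = refl
length-descRun lo (suc k) = cong suc (length-descRun lo k)

descRun-++ : ∀ lo a b → descRun lo (a + b) ≡ descRun (lo + b) a ++ descRun lo b
descRun-++ lo zero b = refl
descRun-++ lo (suc a) b = cong₂ _∷_ (trans (cong (lo +_) (+-comm a b)) (sym (+-assoc lo b a))) (descRun-++ lo a b)

highLowMid : ℕ → ℕ → ℕ → List ℕ
highLowMid h l g = descRun (suc (g + l)) h ++ descRun 1 l ++ descRun (suc l) g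

midHighLow : ℕ → ℕ → ℕ → List ℕ
midHighLow a b c = descRun (suc b) a ++ descRun (suc (a + b)) c ++ descRun 1 b

Decreasing-inRange-length : ∀ b xs → Decreasing xs → All (InRange b) xs → length xs ≤ b
Decreasing-inRange-length b [] _ _ = z≤n
Decreasing-inRange-length b (suc y ∷ ys) (r ∷ d) ((_ , y≤b) ∷ rs) =
  ≤-trans (s≤s (Decreasing-inRange-length y ys d (All.zipWith (λ ((y′≥1 , _) , y′<y) → y′≥1 , s≤s⁻¹ y′<y) (rs , r)))) y≤b
Decreasing-inRange-length b (zero ∷ ys) _ ((() , _) ∷ _)

Decreasing⇒descRun : ∀ n xs → Decreasing xs → All (InRange n) xs → length xs ≡ n → xs ≡ descRun 1 n
Decreasing⇒descRun zero [] _ _ _ = refl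
Decreasing⇒descRun (suc n) (zero ∷ ys) _ ((() , _) ∷ _) _
Decreasing⇒descRun (suc n) (suc y ∷ ys) (r ∷ d) ((_ , y≤n) ∷ rs) len =
  cong₂ _∷_ (cong suc y≡n) (Decreasing⇒descRun n ys d (subst (λ z → All (InRange z) ys) y≡n ys≤y) (suc-injective len))
  where
  ys≤y : All (InRange y) ys
  ys≤y = All.zipWith (λ ((y′≥1 , _) , y′<y) → y′≥1 , s≤s⁻¹ y′<y) (rs , r)
  y≡n : y ≡ n
  y≡n = ≤-antisym (s≤s⁻¹ y≤n) (subst (_≤ y) (suc-injective len) (Decreasing-inRange-length y ys d ys≤y))

++-split : ∀ (xs ys us vs : List ℕ) → xs ++ ys ≡ us ++ vs → length xs ≡ length us → xs ≡ us × ys ≡ vs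
++-split [] ys [] vs e _ = refl , e
++-split (x ∷ xs) ys (u ∷ us) vs e l with ∷-injective e
... | refl , e′ with ++-split xs ys us vs e′ (suc-injective l)
...   | refl , r = refl , r


Shape₁⇒highLowMid : ∀ n π → Shape₁ π → All (InRange n) π → length π ≡ n →
  ∃ λ h → ∃ λ l → ∃ λ g → n ≡ h + (g + l) × π ≡ highLowMid h l g
Shape₁⇒highLowMid n π (H , L , G , refl , dH , dL , dG , H≫ , G≫L) inRange len =
  h , l , g , n≡ , cong₂ _++_ (proj₁ splitH) (cong₂ _++_ (proj₂ splitG) (proj₁ splitG))
  where
  h = length H
  l = length L
  g = length G
  sorted : Decreasing (H ++ G ++ L)
  sorted = AllPairsₚ.++⁺ dH (AllPairsₚ.++⁺ dG dL G≫L) (All.map (All-++-comm L) H≫)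
  n≡ : n ≡ h + (g + l)
  n≡ = trans (sym len) (trans (length-++ H) (cong (h +_) (trans (length-++ L) (+-comm l g))))
  values : H ++ G ++ L ≡ descRun (suc (g + l)) h ++ descRun (suc l) g ++ descRun 1 l
  values = begin
    H ++ G ++ L ≡⟨ Decreasing⇒descRun n _ sorted (Allₚ.++⁺ (Allₚ.++⁻ˡ H inRange) (All-++-comm L (Allₚ.++⁻ʳ H inRange)))
                     (trans (length-++ H) (trans (cong (h +_) (length-++ G)) (sym n≡))) ⟩
    descRun 1 n ≡⟨ cong (descRun 1) n≡ ⟩
    descRun 1 (h + (g + l)) ≡⟨ descRun-++ 1 h (g + l) ⟩
    descRun (suc (g + l)) h ++ descRun 1 (g + l) ≡⟨ cong (descRun (suc (g + l)) h ++_) (descRun-++ 1 g l) ⟩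
    descRun (suc (g + l)) h ++ descRun (suc l) g ++ descRun 1 l ∎
    where open ≡-Reasoning
  splitH = ++-split H (G ++ L) (descRun (suc (g + l)) h) (descRun (suc l) g ++ descRun 1 l) values (sym (length-descRun _ h))
  splitG = ++-split G L (descRun (suc l) g) (descRun 1 l) (proj₂ splitH) (sym (length-descRun _ g))

Shape₂⇒midHighLow : ∀ n π → Shape₂ π → All (InRange n) π → length π ≡ n →
  ∃ λ a → ∃ λ b → ∃ λ c → n ≡ c + (a + b) × π ≡ midHighLow a b c
Shape₂⇒midHighLow n π (M , T , B , refl , dM , dT , dB , T≫M , M≫B , T≫B) inRange len =
  a , b , c , n≡ , cong₂ _++_ (proj₁ splitM) (cong₂ _++_ (proj₁ splitT) (proj₂ splitM))
  where
  a = length M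
  b = length B
  c = length T
  sorted : Decreasing (T ++ M ++ B)
  sorted = AllPairsₚ.++⁺ dT (AllPairsₚ.++⁺ dM dB M≫B) (≫-++ T≫M T≫B)
  n≡ : n ≡ c + (a + b)
  n≡ = trans (sym len) (trans (length-++ M) (trans (cong (a +_) (length-++ T))
         (trans (sym (+-assoc a c b)) (trans (cong (_+ b) (+-comm a c)) (+-assoc c a b)))))
  values : T ++ M ++ B ≡ descRun (suc (a + b)) c ++ descRun (suc b) a ++ descRun 1 b
  values = begin
    T ++ M ++ B ≡⟨ Decreasing⇒descRun n _ sorted
                     (Allₚ.++⁺ (Allₚ.++⁻ˡ T (Allₚ.++⁻ʳ M inRange)) (Allₚ.++⁺ (Allₚ.++⁻ˡ M inRange) (Allₚ.++⁻ʳ T (Allₚ.++⁻ʳ M inRange))))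
                     (trans (length-++ T) (trans (cong (c +_) (length-++ M)) (sym n≡))) ⟩
    descRun 1 n ≡⟨ cong (descRun 1) n≡ ⟩
    descRun 1 (c + (a + b)) ≡⟨ descRun-++ 1 c (a + b) ⟩
    descRun (suc (a + b)) c ++ descRun 1 (a + b) ≡⟨ cong (descRun (suc (a + b)) c ++_) (descRun-++ 1 a b) ⟩
    descRun (suc (a + b)) c ++ descRun (suc b) a ++ descRun 1 b ∎
    where open ≡-Reasoning
  splitT = ++-split T (M ++ B) (descRun (suc (a + b)) c) (descRun (suc b) a ++ descRun 1 b) values (sym (length-descRun _ c))
  splitM = ++-split M B (descRun (suc b) a) (descRun 1 b) (proj₂ splitT) (sym (length-descRun _ a))

-- Outcomes with a single ascent

indexOf : ℕ → List ℕ → ℕ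
indexOf v [] = 0
indexOf v (x ∷ xs) = if x ≡ᵇ v then 0 else suc (indexOf v xs)

indexOf-at : ∀ xs → Unique xs → ∀ q → q < length xs → indexOf (at xs q) xs ≡ q
indexOf-at (x ∷ xs) u zero _ rewrite ≡ᵇ-true x = refl
indexOf-at (x ∷ xs) (x∉ ∷ u) (suc q) (s≤s lt) rewrite ≡ᵇ-false {x} {at xs q} (All.lookup x∉ (at-∈ xs q lt)) =
  cong suc (indexOf-at xs u q lt)

at-map-range : ∀ (g : ℕ → ℕ) a n k → k < n → at (map g (range a n)) k ≡ g (a + k)
at-map-range g a (suc n) zero _ = cong g (sym (+-identityʳ a))
at-map-range g a (suc n) (suc k) (s≤s lt) = trans (at-map-range g (suc a) n k lt) (cong g (sym (+-suc a k)))

length-map-range : ∀ (g : ℕ → ℕ) a n → length (map g (range a n)) ≡ n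
length-map-range g a zero = refl
length-map-range g a (suc n) = cong suc (length-map-range g (suc a) n)

-- Every car prefers the spot it occupies in π, except car v, which prefers spot p.
ownSpotPrefs : ℕ → List ℕ → ℕ → ℕ → List ℕ
ownSpotPrefs n π v p = map (λ k → if suc k ≡ᵇ v then p else suc (indexOf (suc k) π)) (range 0 n)

-- π has its only ascent at position qs (every other position starts π or ends a
-- descent), positions lo-1 .. qs-1 hold smaller values than position qs, and
-- position lo-2, if any, holds a larger one.
record SingleAscent (n : ℕ) (π : List ℕ) (qs lo : ℕ) : Set where
  field
    surjective : ∀ v → 1 ≤ v → v ≤ n → v ∈ π
    qs<n : qs < n
    1≤lo : 1 ≤ lo
    descentElsewhere : ∀ q → q < n → q ≢ qs → q ≡ 0 ⊎ ∃ λ r → q ≡ suc r × at π q < at π r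
    blockedBelow : lo ≡ 1 ⊎ ∃ λ r → lo ≡ suc (suc r) × r < qs × at π qs < at π r
    smallerBetween : ∀ j → lo ≤ suc j → j < qs → at π j < at π qs

-- The parking functions with outcome π are exactly the preference lists in which
-- every car prefers its own spot except the car at the ascent, which may prefer
-- any spot lo .. qs+1.
module SingleAscentFibre {n π qs lo} (perm : IsPermutation n π) (asc : SingleAscent n π qs lo) where
  open IsPermutation perm
  open SingleAscent asc

  v : ℕ
  v = at π qs

  prefs : ℕ → List ℕ
  prefs t = ownSpotPrefs n π v (lo + t)

  length-prefs : ∀ t → length (prefs t) ≡ n
  length-prefs t = length-map-range _ 0 n

  at-prefs : ∀ t k → k < n → at (prefs t) k ≡ (if suc k ≡ᵇ v then lo + t else suc (indexOf (suc k) π))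
  at-prefs t k lt = at-map-range _ 0 n k lt

  positionOf : ∀ k → k < n → ∃ λ q → q < n × at π q ≡ suc k
  positionOf k lt with ∈⇒at π (surjective (suc k) (s≤s z≤n) lt)
  ... | q , lq , e = q , subst (q <_) length≡ lq , e

  prefs-own : ∀ t q → q < n → q ≢ qs → at (prefs t) (pred (at π q)) ≡ suc q
  prefs-own t q lq ne with at π q in πq
  ... | zero = ⊥-elim (<-irrefl (sym πq) (proj₁ (at-inRange q lq)))
  ... | suc k = trans (at-prefs t k k<n) (choose (suc k ≡ᵇ v) refl)
    where
    k<n : k < n
    k<n = subst (_≤ n) πq (proj₂ (at-inRange q lq))
    choose : ∀ b → (suc k ≡ᵇ v) ≡ b → (if b then lo + t else suc (indexOf (suc k) π)) ≡ suc q
    choose true e = ⊥-elim (ne (at-injective q qs lq qs<n (trans πq (≡ᵇ-sound e))))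
    choose false e = cong suc (subst (λ w → indexOf w π ≡ q) πq (indexOf-at π distinct q (subst (q <_) (sym length≡) lq)))

  prefs-ascent : ∀ t → at (prefs t) (pred v) ≡ lo + t
  prefs-ascent t = choose v refl
    where
    choose : ∀ w → v ≡ w → at (prefs t) (pred w) ≡ lo + t
    choose zero e = ⊥-elim (<-irrefl (sym e) (proj₁ (at-inRange qs qs<n)))
    choose (suc k) e = trans (at-prefs t k (subst (_≤ n) e (proj₂ (at-inRange qs qs<n))))
      (cong (λ b → if b then lo + t else suc (indexOf (suc k) π)) (trans (cong (suc k ≡ᵇ_) e) (≡ᵇ-true k)))

  prefs-parksAs : ∀ t → lo + t ≤ suc qs → ParksAs n (prefs t) π
  prefs-parksAs t le k lk with positionOf k lk
  ... | q , lq , e with q ≟ qs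
  ...   | no ne = q , lq , e , ≤-reflexive own , λ j jq lej → ⊥-elim (<⇒≱ (s≤s jq) (subst (_≤ suc j) own lej))
    where
    own : at (prefs t) k ≡ suc q
    own = subst (λ w → at (prefs t) (pred w) ≡ suc q) e (prefs-own t q lq ne)
  ...   | yes refl = q , lq , e , ≤-trans (≤-reflexive chosen) le , λ j jq lej →
            proj₁ (at-inRange j (<-trans jq qs<n)) ,
            s≤s⁻¹ (subst (at π j <_) e (smallerBetween j (≤-trans (m≤m+n lo t) (subst (_≤ suc j) chosen lej)) jq))
    where
    chosen : at (prefs t) k ≡ lo + t
    chosen = subst (λ w → at (prefs t) (pred w) ≡ lo + t) e (prefs-ascent t)

  prefs-inRange : ∀ t → lo + t ≤ suc qs → All (InRange n) (prefs t)
  prefs-inRange t le = at⇒All (prefs t) λ k lk → entry k (subst (k <_) (length-prefs t) lk)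
    where
    entry : ∀ k → k < n → InRange n (at (prefs t) k)
    entry k lk with positionOf k lk
    ... | q , lq , e with q ≟ qs
    ...   | no ne = subst (InRange n) (sym (subst (λ w → at (prefs t) (pred w) ≡ suc q) e (prefs-own t q lq ne))) (s≤s z≤n , lq)
    ...   | yes refl = subst (InRange n) (sym (subst (λ w → at (prefs t) (pred w) ≡ lo + t) e (prefs-ascent t)))
              (≤-trans 1≤lo (m≤m+n lo t) , ≤-trans le lq)

  prefs-injective : ∀ t t′ → prefs t ≡ prefs t′ → t ≡ t′
  prefs-injective t t′ e = +-cancelˡ-≡ lo t t′ (trans (sym (prefs-ascent t)) (trans (cong (λ l → at l (pred v)) e) (prefs-ascent t′)))

  module _ {f : List ℕ} (length-f : length f ≡ n) (f-inRange : All (InRange n) f) (parks : ParksAs n f π) where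

    preference : ∀ k → k < n → InRange n (at f k)
    preference k lk = All-at f-inRange k (subst (k <_) (sym length-f) lk)

    carAt : ∀ q → q < n → ∃ λ k → at π q ≡ suc k × at f k ≤ suc q ×
              (∀ j → j < q → at f k ≤ suc j → 0 < at π j × at π j ≤ k)
    carAt q lq with at π q in πq
    ... | zero = ⊥-elim (<-irrefl (sym πq) (proj₁ (at-inRange q lq)))
    ... | suc k with parks k (subst (_≤ n) πq (proj₂ (at-inRange q lq)))
    ...   | q′ , lq′ , e′ , le′ , h′ with at-injective q q′ lq lq′ (trans πq (sym e′))
    ...     | refl = k , refl , le′ , h′

    -- Spot q (the one just before q+1) holds a later car when q+1 ends a descent.
    forced : ∀ q → q < n → q ≢ qs → ∃ λ k → at π q ≡ suc k × at f k ≡ suc q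
    forced q lq ne with carAt q lq
    ... | k , e , le , h with descentElsewhere q lq ne
    ...   | inj₁ refl = k , e , ≤-antisym le (proj₁ (preference k (subst (_≤ n) e (proj₂ (at-inRange q lq)))))
    ...   | inj₂ (r , refl , dsc) = k , e , ≤-antisym le (≰⇒> λ f≤ → <⇒≱ (subst (_< at π r) e dsc) (m≤n⇒m≤1+n (proj₂ (h r ≤-refl f≤))))

    ascentCar : ∃ λ k → v ≡ suc k × lo ≤ at f k × at f k ≤ suc qs
    ascentCar with carAt qs qs<n
    ... | k , e , le , h = k , e , aboveLo blockedBelow , le
      where
      aboveLo : (lo ≡ 1 ⊎ ∃ λ r → lo ≡ suc (suc r) × r < qs × at π qs < at π r) → lo ≤ at f k
      aboveLo (inj₁ refl) = proj₁ (preference k (subst (_≤ n) e (proj₂ (at-inRange qs qs<n))))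
      aboveLo (inj₂ (r , refl , rq , big)) = ≰⇒> λ f≤ → <⇒≱ (subst (_< at π r) e big) (m≤n⇒m≤1+n (proj₂ (h r rq f≤)))

    parksAs⇒prefs : ∃ λ t → lo + t ≤ suc qs × f ≡ prefs t
    parksAs⇒prefs = t , lo+t≤ , at-extensionality f (prefs t) (trans length-f (sym (length-prefs t))) λ k lk → agree k (subst (k <_) length-f lk)
      where
      ks = proj₁ ascentCar
      t : ℕ
      t = at f ks ∸ lo
      lo+t : lo + t ≡ at f ks
      lo+t = m+[n∸m]≡n (proj₁ (proj₂ (proj₂ ascentCar)))
      lo+t≤ : lo + t ≤ suc qs
      lo+t≤ = subst (_≤ suc qs) (sym lo+t) (proj₂ (proj₂ (proj₂ ascentCar)))
      agree : ∀ k → k < n → at f k ≡ at (prefs t) k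
      agree k lk with positionOf k lk
      ... | q , lq , e with q ≟ qs
      ...   | no ne with forced q lq ne
      ...     | k′ , e′ , fe with suc-injective (trans (sym e) e′)
      ...       | refl = trans fe (sym (subst (λ w → at (prefs t) (pred w) ≡ suc q) e (prefs-own t q lq ne)))
      agree k lk | q , lq , e | yes refl with suc-injective (trans (sym e) (proj₁ (proj₂ ascentCar)))
      ...       | refl = trans (sym lo+t) (sym (subst (λ w → at (prefs t) (pred w) ≡ lo + t) e (prefs-ascent t)))

descRun-bounds : ∀ lo k → All (λ x → lo ≤ x × x < lo + k) (descRun lo k)
descRun-bounds lo zero = []
descRun-bounds lo (suc k) = (m≤m+n lo k , subst (lo + k <_) (sym (+-suc lo k)) ≤-refl) ∷
  All.map (λ (lo≤x , x<) → lo≤x , ≤-trans x< (subst (lo + k ≤_) (sym (+-suc lo k)) (n≤1+n _))) (descRun-bounds lo k)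

Decreasing-descRun : ∀ lo k → Decreasing (descRun lo k)
Decreasing-descRun lo zero = []
Decreasing-descRun lo (suc k) = All.map proj₂ (descRun-bounds lo k) ∷ Decreasing-descRun lo k

∈-descRun : ∀ lo k v → lo ≤ v → v < lo + k → v ∈ descRun lo k
∈-descRun lo zero v le lt = ⊥-elim (<⇒≱ lt (subst (_≤ v) (sym (+-identityʳ lo)) le))
∈-descRun lo (suc k) v le lt with v ≟ lo + k
... | yes refl = here refl
... | no ne = there (∈-descRun lo k v le (≤∧≢⇒< (s≤s⁻¹ (subst (v <_) (+-suc lo k) lt)) ne))

descRun-≫ : ∀ lo₁ k₁ lo₂ k₂ → lo₂ + k₂ ≤ lo₁ → descRun lo₁ k₁ ≫ descRun lo₂ k₂
descRun-≫ lo₁ k₁ lo₂ k₂ le =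
  All.map (λ (lo₁≤x , _) → All.map (λ (_ , y<) → <-≤-trans y< (≤-trans le lo₁≤x)) (descRun-bounds lo₂ k₂)) (descRun-bounds lo₁ k₁)

Decreasing⇒Unique : ∀ {xs} → Decreasing xs → Unique xs
Decreasing⇒Unique = AllPairs.map (λ y<x x≡y → <-irrefl (sym x≡y) y<x)

descRun-isPermutation : ∀ n → IsPermutation n (descRun 1 n)
descRun-isPermutation n = record
  { length≡ = length-descRun 1 n
  ; inRange = All.map (λ (1≤x , x<) → 1≤x , s≤s⁻¹ x<) (descRun-bounds 1 n)
  ; distinct = Decreasing⇒Unique (Decreasing-descRun 1 n)
  }

IsPermutation-resp-↭ : ∀ {n π ρ} → π ↭ ρ → IsPermutation n π → IsPermutation n ρ
IsPermutation-resp-↭ π↭ρ perm = record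
  { length≡ = trans (sym (Permₚ.↭-length π↭ρ)) length≡
  ; inRange = Permₚ.All-resp-↭ π↭ρ inRange
  ; distinct = Unique-resp-↭ (↭⇒↭ₛ π↭ρ) distinct
  }
  where open IsPermutation perm

Surjective : ℕ → List ℕ → Set
Surjective n π = ∀ v → 1 ≤ v → v ≤ n → v ∈ π

descRun-surjective : ∀ n → Surjective n (descRun 1 n)
descRun-surjective n v 1≤v v≤n = ∈-descRun 1 n v 1≤v (s≤s v≤n)

Surjective-resp-↭ : ∀ {n π ρ} → π ↭ ρ → Surjective n π → Surjective n ρ
Surjective-resp-↭ π↭ρ surj v 1≤v v≤n = Permₚ.∈-resp-↭ π↭ρ (surj v 1≤v v≤n)

descRun↭highLowMid : ∀ h l g → descRun 1 (h + (g + l)) ↭ highLowMid h l g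
descRun↭highLowMid h l g = ↭-trans
  (↭-reflexive (trans (descRun-++ 1 h (g + l)) (cong (descRun (suc (g + l)) h ++_) (descRun-++ 1 g l))))
  (Permₚ.++⁺ˡ (descRun (suc (g + l)) h) (Permₚ.++-comm (descRun (suc l) g) (descRun 1 l)))

descRun↭midHighLow : ∀ a b c → descRun 1 (c + (a + b)) ↭ midHighLow a b c
descRun↭midHighLow a b c = ↭-trans
  (↭-reflexive (trans (descRun-++ 1 c (a + b)) (trans (cong (descRun (suc (a + b)) c ++_) (descRun-++ 1 a b))
    (sym (++-assoc (descRun (suc (a + b)) c) (descRun (suc b) a) (descRun 1 b))))))
  (↭-trans (Permₚ.++⁺ʳ (descRun 1 b) (Permₚ.++-comm (descRun (suc (a + b)) c) (descRun (suc b) a)))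
    (↭-reflexive (++-assoc (descRun (suc b) a) (descRun (suc (a + b)) c) (descRun 1 b))))

⊆-++-split : ∀ {s : List ℕ} (xs ys : List ℕ) → s ⊆ xs ++ ys → ∃ λ s₁ → ∃ λ s₂ → s ≡ s₁ ++ s₂ × s₁ ⊆ xs × s₂ ⊆ ys
⊆-++-split [] ys s⊆ = [] , _ , refl , [] , s⊆
⊆-++-split (x ∷ xs) ys (.x ∷ʳ s⊆) with ⊆-++-split xs ys s⊆
... | s₁ , s₂ , e , a , b = s₁ , s₂ , e , x ∷ʳ a , b
⊆-++-split (x ∷ xs) ys (refl ∷ s⊆) with ⊆-++-split xs ys s⊆
... | s₁ , s₂ , e , a , b = x ∷ s₁ , s₂ , cong (x ∷_) e , refl ∷ a , b

Decreasing-noAscent : ∀ {xs a b} → Decreasing xs → (a ∷ b ∷ []) ⊆ xs → ¬ a < b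
Decreasing-noAscent d s a<b = <-asym a<b (AllPairs-pair d s)

no123-++ : ∀ {X Y} → Decreasing X → Decreasing Y → ¬ Occurs Is123 (X ++ Y)
no123-++ {X} {Y} dX dY (a , b , c , s⊆ , a<b , b<c) with ⊆-++-split X Y s⊆
... | [] , _ , refl , _ , s₂ = Decreasing-noAscent dY (⊆-trans (refl ∷ refl ∷ _ ∷ʳ []) s₂) a<b
... | _ ∷ [] , _ , refl , _ , s₂ = Decreasing-noAscent dY s₂ b<c
... | _ ∷ _ ∷ [] , _ , refl , s₁ , _ = Decreasing-noAscent dX s₁ a<b
... | _ ∷ _ ∷ _ ∷ [] , _ , refl , s₁ , _ = Decreasing-noAscent dX (⊆-trans (refl ∷ refl ∷ _ ∷ʳ []) s₁) a<b

Shape₁⇒avoiding : ∀ {π} → Shape₁ π → ¬ Occurs Is123 π × ¬ Occurs Is231 π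
Shape₁⇒avoiding (H , L , G , refl , dH , dL , dG , H≫ , G≫L) =
  (λ (a , b , c , s⊆ , p) → no123-++ dHL dG (a , b , c , assoc s⊆ , p)) , no231
  where
  dHL : Decreasing (H ++ L)
  dHL = AllPairsₚ.++⁺ dH dL (All.map (Allₚ.++⁻ˡ L) H≫)
  assoc : ∀ {s} → s ⊆ H ++ L ++ G → s ⊆ (H ++ L) ++ G
  assoc {s} = subst (s ⊆_) (sym (++-assoc H L G))
  no231 : ¬ Occurs Is231 (H ++ L ++ G)
  no231 (a , b , c , s⊆ , c<a , a<b) with ⊆-++-split (H ++ L) G (assoc s⊆)
  ... | [] , _ , refl , _ , s₂ = Decreasing-noAscent dG (⊆-trans (refl ∷ refl ∷ _ ∷ʳ []) s₂) a<b
  ... | _ ∷ _ ∷ [] , _ , refl , s₁ , _ = Decreasing-noAscent dHL s₁ a<b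
  ... | _ ∷ _ ∷ _ ∷ [] , _ , refl , s₁ , _ = Decreasing-noAscent dHL (⊆-trans (refl ∷ refl ∷ _ ∷ʳ []) s₁) a<b
  ... | _ ∷ [] , _ , refl , s₁ , s₂ with ∈-++⁻ H (to∈ s₁)
  ...   | inj₁ a∈H = <-asym a<b (All.lookup (All.lookup H≫ a∈H) (∈-++⁺ʳ L (to∈ s₂)))
  ...   | inj₂ a∈L = <-asym c<a (All.lookup (All.lookup G≫L (to∈ (⊆-trans (_ ∷ʳ refl ∷ []) s₂))) a∈L)

Shape₂⇒avoiding : ∀ {π} → Shape₂ π → ¬ Occurs Is123 π × ¬ Occurs Is312 π
Shape₂⇒avoiding (M , T , B , refl , dM , dT , dB , T≫M , M≫B , T≫B) =
  (λ occ → no123-++ dM dTB occ) , no312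
  where
  dTB : Decreasing (T ++ B)
  dTB = AllPairsₚ.++⁺ dT dB T≫B
  no312 : ¬ Occurs Is312 (M ++ T ++ B)
  no312 (a , b , c , s⊆ , b<c , c<a) with ⊆-++-split M (T ++ B) s⊆
  ... | [] , _ , refl , _ , s₂ = Decreasing-noAscent dTB (⊆-trans (_ ∷ʳ refl ∷ refl ∷ []) s₂) b<c
  ... | _ ∷ [] , _ , refl , _ , s₂ = Decreasing-noAscent dTB s₂ b<c
  ... | _ ∷ _ ∷ _ ∷ [] , _ , refl , s₁ , _ = Decreasing-noAscent dM (⊆-trans (_ ∷ʳ refl ∷ refl ∷ []) s₁) b<c
  ... | _ ∷ _ ∷ [] , _ , refl , s₁ , s₂ with ∈-++⁻ T (to∈ s₂)
  ...   | inj₁ c∈T = <-asym c<a (All.lookup (All.lookup T≫M c∈T) (to∈ s₁))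
  ...   | inj₂ c∈B = <-asym b<c (All.lookup (All.lookup M≫B (to∈ (⊆-trans (_ ∷ʳ refl ∷ []) s₁))) c∈B)

highLowMid-Shape₁ : ∀ h l g → Shape₁ (highLowMid h l g)
highLowMid-Shape₁ h l g = _ , _ , _ , refl , Decreasing-descRun _ h , Decreasing-descRun 1 l , Decreasing-descRun _ g ,
  ≫-++ (descRun-≫ _ h 1 l (s≤s (m≤n+m l g))) (descRun-≫ _ h _ g (≤-reflexive (cong suc (+-comm l g)))) ,
  descRun-≫ _ g 1 l ≤-refl

midHighLow-Shape₂ : ∀ a b c → Shape₂ (midHighLow a b c)
midHighLow-Shape₂ a b c = _ , _ , _ , refl , Decreasing-descRun _ a , Decreasing-descRun _ c , Decreasing-descRun 1 b ,
  descRun-≫ _ c _ a (≤-reflexive (cong suc (+-comm b a))) , descRun-≫ _ a 1 b ≤-refl , descRun-≫ _ c 1 b (s≤s (m≤n+m b a))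

at-++ˡ-∈ : ∀ xs ys k → k < length xs → at (xs ++ ys) k ∈ xs
at-++ˡ-∈ xs ys k lt = subst (_∈ xs) (sym (at-++ˡ xs ys k lt)) (at-∈ xs k lt)

at-++ʳ-∈ : ∀ xs ys k → k < length ys → at (xs ++ ys) (length xs + k) ∈ ys
at-++ʳ-∈ xs ys k lt = subst (_∈ ys) (sym (at-++ʳ xs ys k)) (at-∈ ys k lt)

Decreasing-at : ∀ {xs} → Decreasing xs → ∀ i → suc i < length xs → at xs (suc i) < at xs i
Decreasing-at {x ∷ xs} (r ∷ d) zero lt = All.lookup r (at-∈ xs 0 (s≤s⁻¹ lt))
Decreasing-at {x ∷ xs} (r ∷ d) (suc i) (s≤s lt) = Decreasing-at d i lt

descentsOutside : ∀ A B → Decreasing A → Decreasing B → ∀ q → q < length A + length B → q ≢ length A →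
  q ≡ 0 ⊎ ∃ λ r → q ≡ suc r × at (A ++ B) q < at (A ++ B) r
descentsOutside A B dA dB zero _ _ = inj₁ refl
descentsOutside A B dA dB (suc r) lt ne with suc r <? length A
... | yes inA = inj₂ (r , refl , subst₂ _<_ (sym (at-++ˡ A B (suc r) inA)) (sym (at-++ˡ A B r (≤-trans (n≤1+n _) inA))) (Decreasing-at dA r inA))
... | no notInA = inj₂ (r , refl , inB)
  where
  j : ℕ
  j = r ∸ length A
  r≡ : length A + j ≡ r
  r≡ = m+[n∸m]≡n (s≤s⁻¹ (≤∧≢⇒< (≮⇒≥ notInA) (λ e → ne (sym e))))
  j+1<B : suc j < length B
  j+1<B = +-cancelˡ-< (length A) _ _ (subst (_< length A + length B) (trans (cong suc (sym r≡)) (sym (+-suc (length A) j))) lt)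
  inB : at (A ++ B) (suc r) < at (A ++ B) r
  inB = subst₂ _<_ (trans (sym (at-++ʳ A B (suc j))) (cong (at (A ++ B)) (trans (+-suc (length A) j) (cong suc r≡))))
                   (trans (sym (at-++ʳ A B j)) (cong (at (A ++ B)) r≡)) (Decreasing-at dB j j+1<B)

module _ (h l g : ℕ) (1≤l : 1 ≤ l) (1≤g : 1 ≤ g) where
  private
    H L G : List ℕ
    H = descRun (suc (g + l)) h
    L = descRun 1 l
    G = descRun (suc l) g
    π = highLowMid h l g
    qs = h + l
    H≫L : H ≫ L
    H≫L = descRun-≫ _ h 1 l (s≤s (m≤n+m l g))
    H≫G : H ≫ G
    H≫G = descRun-≫ _ h _ g (≤-reflexive (cong suc (+-comm l g)))
    G≫L : G ≫ L
    G≫L = descRun-≫ _ g 1 l ≤-refl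
    π≡ : π ≡ (H ++ L) ++ G
    π≡ = sym (++-assoc H L G)
    length-HL : length (H ++ L) ≡ qs
    length-HL = trans (length-++ H) (cong₂ _+_ (length-descRun _ h) (length-descRun _ l))
    length-HLG : length (H ++ L) + length G ≡ h + (g + l)
    length-HLG = trans (cong₂ _+_ length-HL (length-descRun _ g)) (trans (+-assoc h l g) (cong (h +_) (+-comm l g)))
    at-qs∈G : at π qs ∈ G
    at-qs∈G = subst (_∈ G) (trans (cong (λ z → at z (length (H ++ L) + 0)) (sym π≡))
                                  (cong (at π) (trans (+-identityʳ _) length-HL)))
                (at-++ʳ-∈ (H ++ L) G 0 (subst (0 <_) (sym (length-descRun _ g)) 1≤g))
    blocked : ∀ h′ → h′ ≡ h → suc h′ ≡ 1 ⊎ ∃ λ r → suc h′ ≡ suc (suc r) × r < qs × at π qs < at π r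
    blocked zero _ = inj₁ refl
    blocked (suc r) refl = inj₂ (r , refl , m≤m+n (suc r) l ,
      subst (at π qs <_) (sym (at-++ˡ H (L ++ G) r r<h))
        (All.lookup (All.lookup H≫G (at-∈ H r r<h)) at-qs∈G))
      where
      r<h : r < length H
      r<h = subst (r <_) (sym (length-descRun _ (suc r))) ≤-refl
    between : ∀ j → suc h ≤ suc j → j < qs → at π j < at π qs
    between j le lt = All.lookup (All.lookup G≫L at-qs∈G) j∈L
      where
      j′ = j ∸ h
      j≡ : h + j′ ≡ j
      j≡ = m+[n∸m]≡n (s≤s⁻¹ le)
      j′<l : j′ < length L
      j′<l = subst (j′ <_) (sym (length-descRun 1 l)) (+-cancelˡ-< h j′ l (subst (_< h + l) (sym j≡) lt))
      j∈L : at π j ∈ L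
      j∈L = subst (_∈ L) (trans (sym (at-++ˡ L G j′ j′<l)) (trans (sym (at-++ʳ H (L ++ G) j′))
              (trans (cong (λ k → at π (k + j′)) (length-descRun _ h)) (cong (at π) j≡)))) (at-∈ L j′ j′<l)

  highLowMid-singleAscent : SingleAscent (h + (g + l)) (highLowMid h l g) (h + l) (suc h)
  highLowMid-singleAscent = record
    { surjective = Surjective-resp-↭ (descRun↭highLowMid h l g) (descRun-surjective _)
    ; qs<n = +-monoʳ-< h (subst (l <_) (+-comm l g) (m<m+n l 1≤g))
    ; 1≤lo = s≤s z≤n
    ; descentElsewhere = λ q lq ne → subst (λ z → q ≡ 0 ⊎ ∃ λ r → q ≡ suc r × at z q < at z r) (sym π≡)
        (descentsOutside (H ++ L) G (AllPairsₚ.++⁺ (Decreasing-descRun _ h) (Decreasing-descRun 1 l) H≫L) (Decreasing-descRun _ g) q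
          (subst (q <_) (sym length-HLG) lq)
          (λ e → ne (trans e length-HL)))
    ; blockedBelow = blocked h refl
    ; smallerBetween = between
    }

module _ (a b c : ℕ) (1≤a : 1 ≤ a) (1≤c : 1 ≤ c) where
  private
    M T B : List ℕ
    M = descRun (suc b) a
    T = descRun (suc (a + b)) c
    B = descRun 1 b
    π = midHighLow a b c
    T≫M : T ≫ M
    T≫M = descRun-≫ _ c _ a (≤-reflexive (cong suc (+-comm b a)))
    T≫B : T ≫ B
    T≫B = descRun-≫ _ c 1 b (s≤s (m≤n+m b a))
    length-MTB : length M + length (T ++ B) ≡ c + (a + b)
    length-MTB = trans (cong₂ _+_ (length-descRun _ a) (trans (length-++ T) (cong₂ _+_ (length-descRun _ c) (length-descRun 1 b))))
                   (trans (sym (+-assoc a c b)) (trans (cong (_+ b) (+-comm a c)) (+-assoc c a b)))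
    at-a∈T : at π a ∈ T
    at-a∈T = subst (_∈ T) (trans (sym (at-++ʳ M (T ++ B) 0)) (cong (at π) (trans (+-identityʳ _) (length-descRun _ a))))
               (at-++ˡ-∈ T B 0 (subst (0 <_) (sym (length-descRun _ c)) 1≤c))

  midHighLow-singleAscent : SingleAscent (c + (a + b)) (midHighLow a b c) a 1
  midHighLow-singleAscent = record
    { surjective = Surjective-resp-↭ (descRun↭midHighLow a b c) (descRun-surjective _)
    ; qs<n = ≤-trans (s≤s (m≤m+n a b)) (+-monoˡ-≤ (a + b) 1≤c)
    ; 1≤lo = s≤s z≤n
    ; descentElsewhere = λ q lq ne → descentsOutside M (T ++ B) (Decreasing-descRun _ a) (AllPairsₚ.++⁺ (Decreasing-descRun _ c) (Decreasing-descRun 1 b) T≫B) q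
        (subst (q <_) (sym length-MTB) lq) (λ e → ne (trans e (length-descRun _ a)))
    ; blockedBelow = inj₁ refl
    ; smallerBetween = λ j _ j<a → All.lookup (All.lookup T≫M at-a∈T) (at-++ˡ-∈ M (T ++ B) j (subst (j <_) (sym (length-descRun _ a)) j<a))
    }

descRun-singleAscent : ∀ n → 1 ≤ n → SingleAscent n (descRun 1 n) 0 1
descRun-singleAscent n 1≤n = record
  { surjective = descRun-surjective n
  ; qs<n = 1≤n
  ; 1≤lo = s≤s z≤n
  ; descentElsewhere = λ q lq ne → descentsOutside [] (descRun 1 n) [] (Decreasing-descRun 1 n) q (subst (q <_) (sym (length-descRun 1 n)) lq) ne
  ; blockedBelow = inj₁ refl
  ; smallerBetween = λ j _ ()
  }

ascent-unique : ∀ {n π qs lo} → SingleAscent n π qs lo → ∀ q → q < n → 1 ≤ q → at π (pred q) < at π q → q ≡ qs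
ascent-unique {qs = qs} asc q lq 1≤q ascent with q ≟ qs
... | yes e = e
... | no ne with SingleAscent.descentElsewhere asc q lq ne
...   | inj₁ refl = ⊥-elim (<-irrefl refl 1≤q)
...   | inj₂ (r , refl , descent) = ⊥-elim (<-asym descent ascent)

-- Counting

count-filter : ∀ {A : Set} (p : A → Bool) xs → count p xs ≡ length (filter (λ x → p x ≟ᵇ true) xs)
count-filter p [] = refl
count-filter p (x ∷ xs) with p x
... | true = cong suc (count-filter p xs)
... | false = count-filter p xs

-- Two duplicate-free lists with the same members have the same length.
count≡length : ∀ {A : Set} (p : A → Bool) L F → Unique L → Unique F →
  (∀ x → x ∈ F ⇔ (x ∈ L × p x ≡ true)) → count p L ≡ length F
count≡length p L F uL uF F⇔ = trans (count-filter p L)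
  (Permₚ.↭-length (∼bag⇒↭ (unique∧set⇒bag (Uniqueₚ.filter⁺ p? uL) uF
    (mk⇔ (λ m → Equivalence.from (F⇔ _) (∈-filter⁻ p? m)) λ m → let (x∈L , px) = Equivalence.to (F⇔ _) m in ∈-filter⁺ p? x∈L px))))
  where
  p? = λ x → p x ≟ᵇ true

Unique-map⁺-on : ∀ {A B : Set} (g : A → B) {xs} → (∀ {a b} → a ∈ xs → b ∈ xs → g a ≡ g b → a ≡ b) → Unique xs → Unique (map g xs)
Unique-map⁺-on g inj [] = []
Unique-map⁺-on g inj (x∉ ∷ u) =
  Allₚ.map⁺ (All.tabulate λ b∈ e → All.lookup x∉ b∈ (inj (here refl) (there b∈) e))
  ∷ Unique-map⁺-on g (λ a∈ b∈ → inj (there a∈) (there b∈)) u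

Unique-concatMap : ∀ {A B : Set} (g : A → List B) {xs} → Unique xs → (∀ x → Unique (g x)) →
  (∀ {x y z} → z ∈ g x → z ∈ g y → x ≡ y) → Unique (concatMap g xs)
Unique-concatMap g [] _ _ = []
Unique-concatMap g {x ∷ xs} (x∉ ∷ u) ug disjoint = Uniqueₚ.++⁺ (ug x) (Unique-concatMap g u ug disjoint) separate
  where
  separate : ∀ {z} → ¬ (z ∈ g x × z ∈ concatMap g xs)
  separate (z∈gx , z∈rest) with find (∈-concatMap⁻ g {xs = xs} z∈rest)
  ... | y , y∈xs , z∈gy with disjoint z∈gx z∈gy
  ...   | refl = All.lookup x∉ y∈xs refl

∈-range : ∀ a k x → a ≤ x → x < a + k → x ∈ range a k
∈-range a zero x le lt = ⊥-elim (<⇒≱ lt (subst (_≤ x) (sym (+-identityʳ a)) le))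
∈-range a (suc k) x le lt with a ≟ x
... | yes refl = here refl
... | no ne = there (∈-range (suc a) k x (≤∧≢⇒< le ne) (subst (x <_) (+-suc a k) lt))

∈-range⁻ : ∀ a k x → x ∈ range a k → a ≤ x × x < a + k
∈-range⁻ a (suc k) .a (here refl) = ≤-refl , m<m+n a (s≤s z≤n)
∈-range⁻ a (suc k) x (there m) with ∈-range⁻ (suc a) k x m
... | p , q = ≤-trans (n≤1+n a) p , subst (x <_) (sym (+-suc a k)) q

Unique-range : ∀ a k → Unique (range a k)
Unique-range a zero = []
Unique-range a (suc k) = All.tabulate (λ m e → <-irrefl e (proj₁ (∈-range⁻ (suc a) k _ m))) ∷ Unique-range (suc a) k

length-range : ∀ a k → length (range a k) ≡ k
length-range a zero = refl
length-range a (suc k) = cong suc (length-range (suc a) k)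

∈-allWords : ∀ m n f → length f ≡ m → All (InRange n) f → f ∈ allWords m n
∈-allWords zero n [] _ _ = here refl
∈-allWords (suc m) n (x ∷ f) e ((1≤x , x≤n) ∷ rs) = ∈-concatMap⁺ (λ y → map (y ∷_) (allWords m n)) (Any.map (λ { refl → ∈-map⁺ (x ∷_) (∈-allWords m n f (suc-injective e) rs) }) (∈-range 1 n x 1≤x (s≤s x≤n)))

∈-allWords⁻ : ∀ m n f → f ∈ allWords m n → length f ≡ m × All (InRange n) f
∈-allWords⁻ zero n .[] (here refl) = refl , []
∈-allWords⁻ (suc m) n f f∈ with find (∈-concatMap⁻ (λ x → map (x ∷_) (allWords m n)) {xs = range 1 n} f∈)
... | x , x∈ , f∈x with ∈-map⁻ (x ∷_) f∈x
...   | f′ , f′∈ , refl with ∈-allWords⁻ m n f′ f′∈ | ∈-range⁻ 1 n x x∈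
...     | len , rs | 1≤x , x< = cong suc len , (1≤x , s≤s⁻¹ x<) ∷ rs

Unique-allWords : ∀ m n → Unique (allWords m n)
Unique-allWords zero n = [] ∷ []
Unique-allWords (suc m) n = Unique-concatMap (λ x → map (x ∷_) (allWords m n)) (Unique-range 1 n)
  (λ x → Uniqueₚ.map⁺ (λ e → proj₂ (∷-injective e)) (Unique-allWords m n)) sameHead
  where
  sameHead : ∀ {x y z} → z ∈ map (x ∷_) (allWords m n) → z ∈ map (y ∷_) (allWords m n) → x ≡ y
  sameHead zx zy with ∈-map⁻ _ zx | ∈-map⁻ _ zy
  ... | _ , _ , refl | _ , _ , e = proj₁ (∷-injective e)

Params : Set
Params = ℕ × ℕ × ℕ × ℕ

-- (x , y , z , t): block sizes x, z ≥ 1 and y of a permutation of size y + z + x,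
-- and the choice t ≤ x of preference for the car at its ascent.
Valid : ℕ → Params → Set
Valid N (x , y , z , t) = 1 ≤ x × 1 ≤ z × y + (z + x) ≡ N × t ≤ x

incFirst : ℕ × ℕ → ℕ × ℕ
incFirst (a , b) = suc a , b

splits : ℕ → List (ℕ × ℕ)
splits zero = (0 , 0) ∷ []
splits (suc m) = (0 , suc m) ∷ map incFirst (splits m)

∈-splits : ∀ a b → (a , b) ∈ splits (a + b)
∈-splits zero zero = here refl
∈-splits zero (suc b) = here refl
∈-splits (suc a) b = there (∈-map⁺ _ (∈-splits a b))

∈-splits⁻ : ∀ m a b → (a , b) ∈ splits m → a + b ≡ m
∈-splits⁻ zero .0 .0 (here refl) = refl
∈-splits⁻ (suc m) .0 .(suc m) (here refl) = refl
∈-splits⁻ (suc m) a b (there p) with ∈-map⁻ _ p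
... | (a′ , b′) , p′ , refl = cong suc (∈-splits⁻ m a′ b′ p′)

Unique-splits : ∀ m → Unique (splits m)
Unique-splits zero = [] ∷ []
Unique-splits (suc m) =
  All.tabulate (λ p e → case ∈-map⁻ _ p of λ { (_ , _ , refl) → case e of λ () })
  ∷ Uniqueₚ.map⁺ (λ { refl → refl }) (Unique-splits m)

length-splits : ∀ m → length (splits m) ≡ suc m
length-splits zero = refl
length-splits (suc m) = cong suc (trans (length-map _ (splits m)) (length-splits m))

withChoices : ℕ × ℕ → List Params
withChoices (a , b) = map (λ t → suc a , 0 , suc b , t) (range 0 (suc (suc a)))

incY : Params → Params
incY (x , y , z , t) = x , suc y , z , t

-- Parameters with y = 0 are new at size N; the others come from size N − 1.
params : ℕ → List Params
params zero = []
params (suc zero) = []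
params (suc (suc m)) = map incY (params (suc m)) ++ concatMap withChoices (splits m)

∈-params : ∀ N x y z t → Valid N (x , y , z , t) → (x , y , z , t) ∈ params N
∈-params N zero y z t (() , _)
∈-params N x y zero t (_ , () , _)
∈-params N (suc a) (suc y) (suc b) t (1≤x , 1≤z , refl , t≤x) with y + (suc b + suc a) in eN
... | zero = ⊥-elim (1+n≢0 (trans (sym (+-suc y (b + suc a))) eN))
... | suc m = ∈-++⁺ˡ (∈-map⁺ incY (∈-params (suc m) (suc a) y (suc b) t (1≤x , 1≤z , eN , t≤x)))
∈-params N (suc a) zero (suc b) t (_ , _ , refl , t≤x) = subst (λ N → (suc a , 0 , suc b , t) ∈ params N) N≡ fresh
  where
  N≡ : suc (suc (a + b)) ≡ suc b + suc a
  N≡ = cong suc (trans (cong suc (+-comm a b)) (sym (+-suc b a)))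
  fresh : (suc a , 0 , suc b , t) ∈ params (suc (suc (a + b)))
  fresh = ∈-++⁺ʳ (map incY (params (suc (a + b))))
    (∈-concatMap⁺ withChoices (Any.map (λ { refl → ∈-map⁺ _ (∈-range 0 (suc (suc a)) t z≤n (s≤s t≤x)) }) (∈-splits a b)))

∈-params⁻ : ∀ N q → q ∈ params N → Valid N q
∈-params⁻ (suc (suc m)) q q∈ with ∈-++⁻ (map incY (params (suc m))) q∈
... | inj₁ old with ∈-map⁻ _ old
...   | (x , y , z , t) , p , refl with ∈-params⁻ (suc m) (x , y , z , t) p
...     | 1≤x , 1≤z , e , t≤x = 1≤x , 1≤z , cong suc e , t≤x
∈-params⁻ (suc (suc m)) q q∈ | inj₂ new with find (∈-concatMap⁻ withChoices {xs = splits m} new)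
... | (a , b) , ab∈ , q∈′ with ∈-map⁻ _ q∈′
...   | t , t∈ , refl = s≤s z≤n , s≤s z≤n ,
          cong suc (trans (+-suc b a) (cong suc (trans (+-comm b a) (∈-splits⁻ m a b ab∈)))) ,
          s≤s⁻¹ (proj₂ (∈-range⁻ 0 (suc (suc a)) t t∈))

Unique-params : ∀ N → Unique (params N)
Unique-params zero = []
Unique-params (suc zero) = []
Unique-params (suc (suc m)) = Uniqueₚ.++⁺ (Uniqueₚ.map⁺ (λ { refl → refl }) (Unique-params (suc m)))
  (Unique-concatMap withChoices (Unique-splits m) (λ _ → Uniqueₚ.map⁺ (λ { refl → refl }) (Unique-range 0 _)) sameSplit)
  λ (old , new) → yPositive old new
  where
  sameSplit : ∀ {p p′ q} → q ∈ withChoices p → q ∈ withChoices p′ → p ≡ p′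
  sameSplit {a , b} {a′ , b′} q∈ q∈′ with ∈-map⁻ _ q∈ | ∈-map⁻ _ q∈′
  ... | _ , _ , refl | _ , _ , refl = refl
  yPositive : ∀ {q} → q ∈ map incY (params (suc m)) → q ∈ concatMap withChoices (splits m) → ⊥
  yPositive old new with ∈-map⁻ _ old | find (∈-concatMap⁻ withChoices {xs = splits m} new)
  ... | _ , _ , refl | _ , _ , q∈ with ∈-map⁻ _ q∈
  ...   | _ , _ , ()

length-withChoices : ∀ a b → length (withChoices (a , b)) ≡ suc (suc a)
length-withChoices a b = trans (length-map _ (range 0 (suc (suc a)))) (length-range 0 (suc (suc a)))

length-withChoices-shift : ∀ ps → length (concatMap withChoices (map incFirst ps)) ≡ length (concatMap withChoices ps) + length ps
length-withChoices-shift [] = refl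
length-withChoices-shift ((a , b) ∷ ps) = begin
  length (withChoices (suc a , b) ++ concatMap withChoices (map incFirst ps))
    ≡⟨ length-++ (withChoices (suc a , b)) ⟩
  length (withChoices (suc a , b)) + length (concatMap withChoices (map incFirst ps))
    ≡⟨ cong₂ _+_ (length-withChoices (suc a) b) (length-withChoices-shift ps) ⟩
  suc (suc (suc a)) + (length (concatMap withChoices ps) + length ps)
    ≡⟨ cong (λ k → suc k + (length (concatMap withChoices ps) + length ps)) (sym (length-withChoices a b)) ⟩
  suc (length (withChoices (a , b))) + (length (concatMap withChoices ps) + length ps)
    ≡⟨ cong suc (sym (+-assoc (length (withChoices (a , b))) _ _)) ⟩
  suc (length (withChoices (a , b)) + length (concatMap withChoices ps) + length ps)
    ≡⟨ sym (+-suc _ (length ps)) ⟩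
  length (withChoices (a , b)) + length (concatMap withChoices ps) + suc (length ps)
    ≡⟨ cong (_+ suc (length ps)) (sym (length-++ (withChoices (a , b)))) ⟩
  length (withChoices (a , b) ++ concatMap withChoices ps) + suc (length ps) ∎
  where open ≡-Reasoning

length-fresh : ∀ m → 2 * length (concatMap withChoices (splits m)) ≡ (m + 1) * (m + 4)
length-fresh zero = refl
length-fresh (suc m) = begin
  2 * length (concatMap withChoices (splits (suc m)))
    ≡⟨ cong (2 *_) (trans (length-++ (withChoices (0 , suc m)) {concatMap withChoices (map incFirst (splits m))}) (cong (2 +_)
         (trans (length-withChoices-shift (splits m)) (cong (length (concatMap withChoices (splits m)) +_) (length-splits m))))) ⟩
  2 * (2 + (length (concatMap withChoices (splits m)) + suc m))
    ≡⟨ expand m (length (concatMap withChoices (splits m))) ⟩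
  2 * length (concatMap withChoices (splits m)) + 2 * (m + 1) + 2 * 2
    ≡⟨ cong (λ k → k + 2 * (m + 1) + 2 * 2) (length-fresh m) ⟩
  (m + 1) * (m + 4) + 2 * (m + 1) + 2 * 2
    ≡⟨ next m ⟩
  (suc m + 1) * (suc m + 4) ∎
  where
  open ≡-Reasoning
  expand : ∀ m L → 2 * (2 + (L + suc m)) ≡ 2 * L + 2 * (m + 1) + 2 * 2
  expand = solve-∀
  next : ∀ m → (m + 1) * (m + 4) + 2 * (m + 1) + 2 * 2 ≡ (suc m + 1) * (suc m + 4)
  next = solve-∀

length-params : ∀ m → 6 * length (params (suc m)) ≡ suc m * m * (suc m + 4)
length-params zero = refl
length-params (suc m) = begin
  6 * length (params (suc (suc m)))
    ≡⟨ cong (6 *_) (trans (length-++ (map incY (params (suc m)))) (cong (_+ length (concatMap withChoices (splits m))) (length-map incY (params (suc m))))) ⟩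
  6 * (length (params (suc m)) + length (concatMap withChoices (splits m)))
    ≡⟨ split (length (params (suc m))) (length (concatMap withChoices (splits m))) ⟩
  6 * length (params (suc m)) + 3 * (2 * length (concatMap withChoices (splits m)))
    ≡⟨ cong₂ (λ u v → u + 3 * v) (length-params m) (length-fresh m) ⟩
  suc m * m * (suc m + 4) + 3 * ((m + 1) * (m + 4))
    ≡⟨ next m ⟩
  suc (suc m) * suc m * (suc (suc m) + 4) ∎
  where
  open ≡-Reasoning
  split : ∀ A B → 6 * (A + B) ≡ 6 * A + 3 * (2 * B)
  split = solve-∀
  next : ∀ m → suc m * m * (suc m + 4) + 3 * ((m + 1) * (m + 4)) ≡ suc (suc m) * suc m * (suc (suc m) + 4)
  next = solve-∀

1+length-params : ∀ m → suc (length (params (suc m))) ≡ suc m * (suc m ∸ 1) * (suc m + 4) / 6 + 1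
1+length-params m = trans (+-comm 1 _) (cong (_+ 1) (sym (trans
  (cong (_/ 6) (trans (sym (length-params m)) (*-comm 6 (length (params (suc m))))))
  (m*n/n≡m (length (params (suc m))) 6))))

SingleAscent-ascent : ∀ {n π qs lo} → SingleAscent n π qs lo → lo ≤ qs → 1 ≤ qs × at π (pred qs) < at π qs
SingleAscent-ascent {qs = suc q} asc lo≤qs = s≤s z≤n , SingleAscent.smallerBetween asc q lo≤qs ≤-refl
SingleAscent-ascent {qs = zero} asc lo≤0 = ⊥-elim (<⇒≱ (SingleAscent.1≤lo asc) lo≤0)

-- The permutations avoiding σs are the decreasing permutation descRun 1 n and a
-- family shape x y z (x, z ≥ 1) of single-ascent permutations with x + 1 choices
-- of preference at the ascent.
record AscentFamily (σs : List (List ℕ)) : Set₁ where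
  field
    Avoids : List ℕ → Set
    avoids⇔ : ∀ π → avoidsAll π σs ≡ true ⇔ Avoids π
    descRun-avoids : ∀ n → Avoids (descRun 1 n)
    shape : ℕ → ℕ → ℕ → List ℕ
    shape-avoids : ∀ x y z → Avoids (shape x y z)
    shape-isPermutation : ∀ x y z → IsPermutation (y + (z + x)) (shape x y z)
    ascentAt lowest : ℕ → ℕ → ℕ → ℕ
    shape-singleAscent : ∀ x y z → 1 ≤ x → 1 ≤ z → SingleAscent (y + (z + x)) (shape x y z) (ascentAt x y z) (lowest x y z)
    lowest+x : ∀ x y z → lowest x y z + x ≡ suc (ascentAt x y z)
    classify : ∀ n π → IsPermutation n π → Avoids π →
      π ≡ descRun 1 n ⊎ ∃ λ x → ∃ λ y → ∃ λ z → 1 ≤ x × 1 ≤ z × y + (z + x) ≡ n × π ≡ shape x y z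
    shape-injective : ∀ x y z x′ y′ z′ → 1 ≤ x → 1 ≤ z → 1 ≤ x′ → 1 ≤ z′ →
      y + (z + x) ≡ y′ + (z′ + x′) → ascentAt x y z ≡ ascentAt x′ y′ z′ → shape x y z ≡ shape x′ y′ z′ →
      x ≡ x′ × y ≡ y′ × z ≡ z′

module Family {σs} (F : AscentFamily σs) where
  open AscentFamily F

  good : ℕ → List ℕ → Bool
  good n f = isParkingFunction n f ∧ avoidsAll (parkingPermutation n f) σs

  good-intro : ∀ {n π} f → length f ≡ n → IsPermutation n π → ParksAs n f π → Avoids π → good n f ≡ true
  good-intro f length-f perm parks avoids = cong₂ _∧_ (parksAs⇒parking f length-f perm parks)
    (trans (cong (λ ρ → avoidsAll ρ σs) (parksAs⇒parkingPermutation f length-f perm parks)) (Equivalence.from (avoids⇔ _) avoids))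

  encode : Params → List ℕ
  encode (x , y , z , t) = ownSpotPrefs (y + (z + x)) (shape x y z) (at (shape x y z) (ascentAt x y z)) (lowest x y z + t)

  identityPrefs : ℕ → List ℕ
  identityPrefs n = ownSpotPrefs n (descRun 1 n) (at (descRun 1 n) 0) (1 + 0)

  family : ℕ → List (List ℕ)
  family n = identityPrefs n ∷ map encode (params n)

  module ShapeFibre (x y z : ℕ) (1≤x : 1 ≤ x) (1≤z : 1 ≤ z) =
    SingleAscentFibre (shape-isPermutation x y z) (shape-singleAscent x y z 1≤x 1≤z)

  module IdentityFibre (n : ℕ) (1≤n : 1 ≤ n) = SingleAscentFibre (descRun-isPermutation n) (descRun-singleAscent n 1≤n)

  choice-bound : ∀ x y z t → t ≤ x → lowest x y z + t ≤ suc (ascentAt x y z)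
  choice-bound x y z t t≤x = subst (lowest x y z + t ≤_) (lowest+x x y z) (+-monoʳ-≤ (lowest x y z) t≤x)

  shape-ascent : ∀ x y z → 1 ≤ x → 1 ≤ z → 1 ≤ ascentAt x y z × at (shape x y z) (pred (ascentAt x y z)) < at (shape x y z) (ascentAt x y z)
  shape-ascent x y z 1≤x 1≤z = SingleAscent-ascent (shape-singleAscent x y z 1≤x 1≤z)
    (s≤s⁻¹ (subst₂ _≤_ (+-comm (lowest x y z) 1) (lowest+x x y z) (+-monoʳ-≤ (lowest x y z) 1≤x)))

  encode-parksAs : ∀ x y z t → 1 ≤ x → 1 ≤ z → t ≤ x → ParksAs (y + (z + x)) (encode (x , y , z , t)) (shape x y z)
  encode-parksAs x y z t 1≤x 1≤z t≤x = ShapeFibre.prefs-parksAs x y z 1≤x 1≤z t (choice-bound x y z t t≤x)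

  encode-parkingPermutation : ∀ x y z t → 1 ≤ x → 1 ≤ z → t ≤ x →
    parkingPermutation (y + (z + x)) (encode (x , y , z , t)) ≡ shape x y z
  encode-parkingPermutation x y z t 1≤x 1≤z t≤x = parksAs⇒parkingPermutation (encode (x , y , z , t))
    (ShapeFibre.length-prefs x y z 1≤x 1≤z t) (shape-isPermutation x y z) (encode-parksAs x y z t 1≤x 1≤z t≤x)

  identity-parksAs : ∀ n → 1 ≤ n → ParksAs n (identityPrefs n) (descRun 1 n)
  identity-parksAs n 1≤n = IdentityFibre.prefs-parksAs n 1≤n 0 (s≤s z≤n)

  identity-parkingPermutation : ∀ n → 1 ≤ n → parkingPermutation n (identityPrefs n) ≡ descRun 1 n
  identity-parkingPermutation n 1≤n = parksAs⇒parkingPermutation (identityPrefs n)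
    (IdentityFibre.length-prefs n 1≤n 0) (descRun-isPermutation n) (identity-parksAs n 1≤n)

  family-sound : ∀ n → 1 ≤ n → ∀ f → f ∈ family n → f ∈ allFunctions n × good n f ≡ true
  family-sound n 1≤n f (here refl) =
    ∈-allWords n n f (IdentityFibre.length-prefs n 1≤n 0) (IdentityFibre.prefs-inRange n 1≤n 0 (s≤s z≤n)) ,
    good-intro f (IdentityFibre.length-prefs n 1≤n 0) (descRun-isPermutation n) (identity-parksAs n 1≤n) (descRun-avoids n)
  family-sound n 1≤n f (there f∈) with ∈-map⁻ encode f∈
  ... | (x , y , z , t) , q∈ , refl with ∈-params⁻ n _ q∈
  ...   | 1≤x , 1≤z , refl , t≤x =
          ∈-allWords _ _ f (ShapeFibre.length-prefs x y z 1≤x 1≤z t) (ShapeFibre.prefs-inRange x y z 1≤x 1≤z t (choice-bound x y z t t≤x)) ,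
          good-intro f (ShapeFibre.length-prefs x y z 1≤x 1≤z t) (shape-isPermutation x y z) (encode-parksAs x y z t 1≤x 1≤z t≤x) (shape-avoids x y z)

  complete-identity : ∀ n → 1 ≤ n → ∀ f → length f ≡ n → All (InRange n) f → ParksAs n f (descRun 1 n) → f ∈ family n
  complete-identity n 1≤n f length-f inRange parks with IdentityFibre.parksAs⇒prefs n 1≤n length-f inRange parks
  ... | zero , _ , refl = here refl
  ... | suc t , s≤s () , _

  complete-shape : ∀ n x y z f → y + (z + x) ≡ n → 1 ≤ x → 1 ≤ z → length f ≡ n → All (InRange n) f → ParksAs n f (shape x y z) → f ∈ family n
  complete-shape .(y + (z + x)) x y z f refl 1≤x 1≤z length-f inRange parks with ShapeFibre.parksAs⇒prefs x y z 1≤x 1≤z length-f inRange parks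
  ... | t , bound , refl = there (∈-map⁺ encode (∈-params _ x y z t (1≤x , 1≤z , refl , t≤x)))
    where
    t≤x : t ≤ x
    t≤x = +-cancelˡ-≤ (lowest x y z) t x (subst (lowest x y z + t ≤_) (sym (lowest+x x y z)) bound)

  family-complete : ∀ n → 1 ≤ n → ∀ f → f ∈ allFunctions n → good n f ≡ true → f ∈ family n
  family-complete n 1≤n f f∈ goodf = place (classify n (parkingPermutation n f) perm avoids)
    where
    length-f = proj₁ (∈-allWords⁻ n n f f∈)
    inRange = proj₂ (∈-allWords⁻ n n f f∈)
    parking = ∧-trueˡ goodf
    parks = parking⇒parksAs f length-f parking
    perm = parkingPermutation-isPermutation f length-f parking
    avoids = Equivalence.to (avoids⇔ _) (∧-trueʳ {isParkingFunction n f} goodf)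
    place : (parkingPermutation n f ≡ descRun 1 n ⊎ ∃ λ x → ∃ λ y → ∃ λ z → 1 ≤ x × 1 ≤ z × y + (z + x) ≡ n × parkingPermutation n f ≡ shape x y z) →
            f ∈ family n
    place (inj₁ ρ≡) = complete-identity n 1≤n f length-f inRange (subst (ParksAs n f) ρ≡ parks)
    place (inj₂ (x , y , z , 1≤x , 1≤z , n≡ , ρ≡)) = complete-shape n x y z f n≡ 1≤x 1≤z length-f inRange (subst (ParksAs n f) ρ≡ parks)

  encode-injective : ∀ n {q q′} → q ∈ params n → q′ ∈ params n → encode q ≡ encode q′ → q ≡ q′
  encode-injective n {x , y , z , t} {x′ , y′ , z′ , t′} q∈ q′∈ e with ∈-params⁻ n _ q∈ | ∈-params⁻ n _ q′∈
  ... | 1≤x , 1≤z , n≡ , t≤x | 1≤x′ , 1≤z′ , n≡′ , t′≤x′ with shape-injective x y z x′ y′ z′ 1≤x 1≤z 1≤x′ 1≤z′ (trans n≡ (sym n≡′)) sameAscent sameShape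
    where
    sameShape : shape x y z ≡ shape x′ y′ z′
    sameShape = begin
      shape x y z ≡⟨ sym (encode-parkingPermutation x y z t 1≤x 1≤z t≤x) ⟩
      parkingPermutation (y + (z + x)) (encode (x , y , z , t)) ≡⟨ cong₂ parkingPermutation (trans n≡ (sym n≡′)) e ⟩
      parkingPermutation (y′ + (z′ + x′)) (encode (x′ , y′ , z′ , t′)) ≡⟨ encode-parkingPermutation x′ y′ z′ t′ 1≤x′ 1≤z′ t′≤x′ ⟩
      shape x′ y′ z′ ∎
      where open ≡-Reasoning
    sameAscent : ascentAt x y z ≡ ascentAt x′ y′ z′
    sameAscent = sym (ascent-unique (shape-singleAscent x y z 1≤x 1≤z) (ascentAt x′ y′ z′)
      (subst (ascentAt x′ y′ z′ <_) (trans n≡′ (sym n≡)) (SingleAscent.qs<n (shape-singleAscent x′ y′ z′ 1≤x′ 1≤z′)))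
      (proj₁ (shape-ascent x′ y′ z′ 1≤x′ 1≤z′))
      (subst (λ π → at π (pred (ascentAt x′ y′ z′)) < at π (ascentAt x′ y′ z′)) (sym sameShape) (proj₂ (shape-ascent x′ y′ z′ 1≤x′ 1≤z′))))
  ... | refl , refl , refl = cong (λ t → x , y , z , t) (ShapeFibre.prefs-injective x y z 1≤x 1≤z t t′ e)

  identity∉encoded : ∀ n → 1 ≤ n → ∀ {q} → q ∈ params n → identityPrefs n ≢ encode q
  identity∉encoded n 1≤n {x , y , z , t} q∈ e with ∈-params⁻ n _ q∈
  ... | 1≤x , 1≤z , refl , t≤x = <-irrefl (sym (ascent-unique (descRun-singleAscent _ 1≤n) (ascentAt x y z)
        (SingleAscent.qs<n (shape-singleAscent x y z 1≤x 1≤z)) (proj₁ (shape-ascent x y z 1≤x 1≤z))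
        (subst (λ π → at π (pred (ascentAt x y z)) < at π (ascentAt x y z)) shape≡descRun (proj₂ (shape-ascent x y z 1≤x 1≤z)))))
        (proj₁ (shape-ascent x y z 1≤x 1≤z))
    where
    shape≡descRun : shape x y z ≡ descRun 1 (y + (z + x))
    shape≡descRun = trans (sym (encode-parkingPermutation x y z t 1≤x 1≤z t≤x))
      (trans (cong (parkingPermutation _) (sym e)) (identity-parkingPermutation _ 1≤n))

  Unique-family : ∀ n → 1 ≤ n → Unique (family n)
  Unique-family n 1≤n = Allₚ.map⁺ (All.tabulate (identity∉encoded n 1≤n)) ∷ Unique-map⁺-on encode (encode-injective n) (Unique-params n)

  pk≡1+length-params : ∀ n → 1 ≤ n → pk n σs ≡ suc (length (params n))
  pk≡1+length-params n 1≤n = trans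
    (count≡length (good n) (allFunctions n) (family n) (Unique-allWords n n) (Unique-family n 1≤n)
      λ f → mk⇔ (family-sound n 1≤n f) (λ (f∈ , goodf) → family-complete n 1≤n f f∈ goodf))
    (cong suc (length-map encode (params n)))

-- The two pattern classes

Decreasing⇒avoiding : ∀ {π} → Decreasing π → ¬ Occurs Is123 π × ¬ Occurs Is231 π × ¬ Occurs Is312 π
Decreasing⇒avoiding d =
  (λ (_ , _ , _ , s⊆ , a<b , _) → Decreasing-noAscent d (⊆-trans (refl ∷ refl ∷ _ ∷ʳ []) s⊆) a<b) ,
  (λ (_ , _ , _ , s⊆ , _ , a<b) → Decreasing-noAscent d (⊆-trans (refl ∷ refl ∷ _ ∷ʳ []) s⊆) a<b) ,
  (λ (_ , _ , _ , s⊆ , b<c , _) → Decreasing-noAscent d (⊆-trans (_ ∷ʳ refl ∷ refl ∷ []) s⊆) b<c)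

σs₁ σs₂ : List (List ℕ)
σs₁ = (1 ∷ 2 ∷ 3 ∷ []) ∷ (2 ∷ 3 ∷ 1 ∷ []) ∷ []
σs₂ = (1 ∷ 2 ∷ 3 ∷ []) ∷ (3 ∷ 1 ∷ 2 ∷ []) ∷ []

highLowMid-degenerate : ∀ h l g → l ≡ 0 ⊎ g ≡ 0 → highLowMid h l g ≡ descRun 1 (h + (g + l))
highLowMid-degenerate h .0 g (inj₁ refl) rewrite +-identityʳ g = sym (descRun-++ 1 h g)
highLowMid-degenerate h l .0 (inj₂ refl) = trans (cong (descRun (suc l) h ++_) (++-identityʳ (descRun 1 l))) (sym (descRun-++ 1 h l))

highLowMid-at-ascent : ∀ h l g → 1 ≤ g → at (highLowMid h l g) (h + l) ≡ l + g
highLowMid-at-ascent h l (suc g) _ = begin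
  at (H ++ L ++ G) (h + l)              ≡⟨ cong (λ k → at (H ++ L ++ G) (k + l)) (sym (length-descRun _ h)) ⟩
  at (H ++ L ++ G) (length H + l)       ≡⟨ at-++ʳ H (L ++ G) l ⟩
  at (L ++ G) l                         ≡⟨ cong (at (L ++ G)) (sym (trans (+-identityʳ _) (length-descRun 1 l))) ⟩
  at (L ++ G) (length L + 0)            ≡⟨ at-++ʳ L G 0 ⟩
  at G 0                                ≡⟨ sym (+-suc l g) ⟩
  l + suc g                             ∎
  where
  open ≡-Reasoning
  H = descRun (suc (suc g + l)) h
  L = descRun 1 l
  G = descRun (suc l) (suc g)

classify₁ : ∀ n π → IsPermutation n π → ¬ Occurs Is123 π × ¬ Occurs Is231 π →
  π ≡ descRun 1 n ⊎ ∃ λ x → ∃ λ y → ∃ λ z → 1 ≤ x × 1 ≤ z × y + (z + x) ≡ n × π ≡ highLowMid y x z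
classify₁ n π perm (no123 , no231) with Shape₁⇒highLowMid n π (avoiding123-231⇒Shape₁ π distinct no123 no231) inRange length≡
  where open IsPermutation perm
... | h , l , g , n≡ , π≡ with l ≟ 0 | g ≟ 0
...   | yes l≡0 | _ = inj₁ (trans π≡ (trans (highLowMid-degenerate h l g (inj₁ l≡0)) (cong (descRun 1) (sym n≡))))
...   | no _ | yes g≡0 = inj₁ (trans π≡ (trans (highLowMid-degenerate h l g (inj₂ g≡0)) (cong (descRun 1) (sym n≡))))
...   | no l≢0 | no g≢0 = inj₂ (l , h , g , n≢0⇒n>0 l≢0 , n≢0⇒n>0 g≢0 , sym n≡ , π≡)

-- The ascent sits at position y + x and carries the value x + z; together with the
-- size y + z + x this determines x, y and z.
highLowMid-injective : ∀ x y z x′ y′ z′ → 1 ≤ x → 1 ≤ z → 1 ≤ x′ → 1 ≤ z′ →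
  y + (z + x) ≡ y′ + (z′ + x′) → y + x ≡ y′ + x′ → highLowMid y x z ≡ highLowMid y′ x′ z′ → x ≡ x′ × y ≡ y′ × z ≡ z′
highLowMid-injective x y z x′ y′ z′ 1≤x 1≤z 1≤x′ 1≤z′ n≡ qs≡ π≡ = x≡ , y≡ , z≡
  where
  value≡ : x + z ≡ x′ + z′
  value≡ = trans (sym (highLowMid-at-ascent y x z 1≤z))
    (trans (cong (at (highLowMid y x z)) qs≡) (trans (cong (λ π → at π (y′ + x′)) π≡) (highLowMid-at-ascent y′ x′ z′ 1≤z′)))
  y≡ : y ≡ y′
  y≡ = +-cancelʳ-≡ (x + z) y y′ (trans (cong (y +_) (+-comm x z)) (trans n≡ (trans (cong (y′ +_) (+-comm z′ x′)) (cong (y′ +_) (sym value≡)))))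
  x≡ : x ≡ x′
  x≡ = +-cancelˡ-≡ y x x′ (trans qs≡ (cong (_+ x′) (sym y≡)))
  z≡ : z ≡ z′
  z≡ = +-cancelˡ-≡ x z z′ (trans value≡ (cong (_+ z′) (sym x≡)))

family₁ : AscentFamily σs₁
family₁ = record
  { Avoids = λ π → ¬ Occurs Is123 π × ¬ Occurs Is231 π
  ; avoids⇔ = λ π → avoidsBoth⇔ π (1 ∷ 2 ∷ 3 ∷ []) (2 ∷ 3 ∷ 1 ∷ []) Is123 Is231 (containsPattern⇔Occurs 1 2 3 Is123 orderIso-123 π) (containsPattern⇔Occurs 2 3 1 Is231 orderIso-231 π)
  ; descRun-avoids = λ n → let (no123 , no231 , _) = Decreasing⇒avoiding (Decreasing-descRun 1 n) in no123 , no231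
  ; shape = λ x y z → highLowMid y x z
  ; shape-avoids = λ x y z → Shape₁⇒avoiding (highLowMid-Shape₁ y x z)
  ; shape-isPermutation = λ x y z → IsPermutation-resp-↭ (descRun↭highLowMid y x z) (descRun-isPermutation _)
  ; ascentAt = λ x y z → y + x
  ; lowest = λ x y z → suc y
  ; shape-singleAscent = λ x y z → highLowMid-singleAscent y x z
  ; lowest+x = λ x y z → refl
  ; classify = classify₁
  ; shape-injective = highLowMid-injective
  }

midHighLow-degenerate : ∀ a b c → a ≡ 0 ⊎ c ≡ 0 → midHighLow a b c ≡ descRun 1 (c + (a + b))
midHighLow-degenerate .0 b c (inj₁ refl) = sym (descRun-++ 1 c b)
midHighLow-degenerate a b .0 (inj₂ refl) = sym (descRun-++ 1 a b)

size₂≡ : ∀ x y z → z + (x + y) ≡ y + (z + x)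
size₂≡ = solve-∀

classify₂ : ∀ n π → IsPermutation n π → ¬ Occurs Is123 π × ¬ Occurs Is312 π →
  π ≡ descRun 1 n ⊎ ∃ λ x → ∃ λ y → ∃ λ z → 1 ≤ x × 1 ≤ z × y + (z + x) ≡ n × π ≡ midHighLow x y z
classify₂ n π perm (no123 , no312) with Shape₂⇒midHighLow n π (avoiding123-312⇒Shape₂ π distinct no123 no312) inRange length≡
  where open IsPermutation perm
... | a , b , c , n≡ , π≡ with a ≟ 0 | c ≟ 0
...   | yes a≡0 | _ = inj₁ (trans π≡ (trans (midHighLow-degenerate a b c (inj₁ a≡0)) (cong (descRun 1) (sym n≡))))
...   | no _ | yes c≡0 = inj₁ (trans π≡ (trans (midHighLow-degenerate a b c (inj₂ c≡0)) (cong (descRun 1) (sym n≡))))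
...   | no a≢0 | no c≢0 = inj₂ (a , b , c , n≢0⇒n>0 a≢0 , n≢0⇒n>0 c≢0 , trans (sym (size₂≡ a b c)) (sym n≡) , π≡)

at-descRun : ∀ lo k j → at (descRun lo (j + suc k)) j ≡ lo + k
at-descRun lo k zero = refl
at-descRun lo k (suc j) = at-descRun lo k j

midHighLow-before-ascent : ∀ a b c → at (midHighLow (suc a) b c) a ≡ suc b
midHighLow-before-ascent a b c = begin
  at (descRun (suc b) (suc a) ++ descRun (suc (suc a + b)) c ++ descRun 1 b) a
    ≡⟨ at-++ˡ (descRun (suc b) (suc a)) _ a (subst (a <_) (sym (length-descRun _ (suc a))) ≤-refl) ⟩
  at (descRun (suc b) (suc a)) a ≡⟨ cong (λ k → at (descRun (suc b) k) a) (sym (+-comm a 1)) ⟩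
  at (descRun (suc b) (a + 1)) a ≡⟨ at-descRun (suc b) 0 a ⟩
  suc b + 0                      ≡⟨ +-identityʳ (suc b) ⟩
  suc b                          ∎
  where open ≡-Reasoning

-- The ascent sits at position x and is preceded by the value y + 1; the size
-- y + z + x then gives z.
midHighLow-injective : ∀ x y z x′ y′ z′ → 1 ≤ x → 1 ≤ z → 1 ≤ x′ → 1 ≤ z′ →
  y + (z + x) ≡ y′ + (z′ + x′) → x ≡ x′ → midHighLow x y z ≡ midHighLow x′ y′ z′ → x ≡ x′ × y ≡ y′ × z ≡ z′
midHighLow-injective (suc a) y z .(suc a) y′ z′ _ _ _ _ n≡ refl π≡ = refl , y≡ , z≡
  where
  y≡ : y ≡ y′
  y≡ = suc-injective (trans (sym (midHighLow-before-ascent a y z)) (trans (cong (λ π → at π a) π≡) (midHighLow-before-ascent a y′ z′)))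
  z≡ : z ≡ z′
  z≡ = +-cancelʳ-≡ (suc a) z z′ (+-cancelˡ-≡ y (z + suc a) (z′ + suc a) (trans n≡ (cong (λ y → y + (z′ + suc a)) (sym y≡))))

family₂ : AscentFamily σs₂
family₂ = record
  { Avoids = λ π → ¬ Occurs Is123 π × ¬ Occurs Is312 π
  ; avoids⇔ = λ π → avoidsBoth⇔ π (1 ∷ 2 ∷ 3 ∷ []) (3 ∷ 1 ∷ 2 ∷ []) Is123 Is312
      (containsPattern⇔Occurs 1 2 3 Is123 orderIso-123 π) (containsPattern⇔Occurs 3 1 2 Is312 orderIso-312 π)
  ; descRun-avoids = λ n → let (no123 , _ , no312) = Decreasing⇒avoiding (Decreasing-descRun 1 n) in no123 , no312
  ; shape = midHighLow
  ; shape-avoids = λ x y z → Shape₂⇒avoiding (midHighLow-Shape₂ x y z)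
  ; shape-isPermutation = λ x y z → subst (λ m → IsPermutation m (midHighLow x y z)) (size₂≡ x y z)
      (IsPermutation-resp-↭ (descRun↭midHighLow x y z) (descRun-isPermutation _))
  ; ascentAt = λ x y z → x
  ; lowest = λ x y z → 1
  ; shape-singleAscent = λ x y z 1≤x 1≤z → subst (λ m → SingleAscent m (midHighLow x y z) x 1) (size₂≡ x y z)
      (midHighLow-singleAscent x y z 1≤x 1≤z)
  ; lowest+x = λ x y z → refl
  ; classify = classify₂
  ; shape-injective = midHighLow-injective
  }

mainTheorem9 : (n : ℕ) → 1 ≤ n →
    (pk n ((1 ∷ 2 ∷ 3 ∷ []) ∷ (2 ∷ 3 ∷ 1 ∷ []) ∷ []) ≡ n * (n ∸ 1) * (n + 4) / 6 + 1)
    × (pk n ((1 ∷ 2 ∷ 3 ∷ []) ∷ (3 ∷ 1 ∷ 2 ∷ []) ∷ []) ≡ n * (n ∸ 1) * (n + 4) / 6 + 1)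
mainTheorem9 (suc m) _ =
  trans (Family.pk≡1+length-params family₁ (suc m) (s≤s z≤n)) (1+length-params m) ,
  trans (Family.pk≡1+length-params family₂ (suc m) (s≤s z≤n)) (1+length-params m)
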